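{- Let $k_1<k_2<\dots<k_n$ be keys (real numbers) with key weights $\beta_1,\dots,\beta_n\ge 0$ and interval weights $\alpha_0,\dots,\alpha_n\ge 0$, and let $\mathcal{S}$ be any valid set (as defined in the context). Fix any key $k_b\in\mathcal{S}$ whose weight $\beta_b$ is largest among the weights of the keys in $\mathcal{S}$. Then among the two-way-comparison trees that handle $\mathcal{S}$, there is one of minimum cost, $T$, that satisfies at least one of the following: (i) $T$ consists of a single leaf; (ii) the root of $T$ performs a less-than comparison $q<k_c$ for some key $k_c$; (iii) the root of $T$ performs an equality test $q=k_b$ to the fixed key $k_b$.
   Context: Setup: keys $k_1<\dots<k_n$; set $k_0=-\infty$, $k_{n+1}=+\infty$ (these are not keys). Key $k_b$ has weight $\beta_b\ge0$ and the open "failure" interval $(k_a,k_{a+1})$, $a=0,\dots,n$, has weight $\alpha_a\ge0$. Valid sets: fix a permutation $\pi$ of $\{1,\dots,n\}$ such that $\beta_{\pi(1)}\le\beta_{\pi(2)}\le\dots\le\beta_{\pi(n)}$ (ties broken arbitrarily). A set $\mathcal{S}$ of possible queries is valid if either $\mathcal{S}=\{k_b\}$ for some key $k_b$, or $\mathcal{S}=\mathcal{S}_{ijh}:=[k_i,k_j)\setminus\{k_{\pi(h+1)},k_{\pi(h+2)},\dots,k_{\pi(n)},k_0\}$ for some $i,j\in\{0,1,\dots,n+1\}$ with $i<j$ and some $h\in\{0,1,\dots,n\}$. Such a set is a union of some keys and some failure intervals $(k_a,k_{a+1})$. Two-way-comparison trees: a rooted binary tree in which every internal node performs either a test $q=k_c$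 or a comparison $q<k_c$ against some key $k_c$, with one child for each outcome, and every leaf is labeled either by a key or by a failure interval. A tree handles $\mathcal{S}$ if its leaves are in one-to-one correspondence with the keys and failure intervals contained in $\mathcal{S}$, and for every query value $q\in\mathcal{S}$, starting at the root and following the outcomes of the comparisons leads to the leaf labeled $k_c$ if $q=k_c$, or to the leaf labeled by the failure interval containing $q$ otherwise. The cost of a tree $T$ is $\sum_{\ell}\mathrm{depth}_T(\ell)\,w(\ell)$ over its leaves $\ell$, where $w(\ell)$ is the weight of the key or interval labeling $\ell$ and the depth is the number of edges from the root to $\ell$.
   Formalization: The key weights $\beta_1,\dots,\beta_n$ and interval weights $\alpha_0,\dots,\alpha_n$ are non-negative rationals rather than arbitrary non-negative numbers. -}

module Defs where

open import Data.Bool using (Bool; true; false; if_then_else_)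
open import Data.Nat as ℕ using (ℕ; zero; suc)
open import Data.Fin as Fin using (Fin; toℕ)
open import Data.Fin.Permutation using (Permutation′; _⟨$⟩ʳ_; _⟨$⟩ˡ_)
open import Data.Integer using (+_)
open import Data.Rational as ℚ using (ℚ; 0ℚ; _/_)
open import Data.List using (List; []; _∷_; _++_)
open import Data.List.Membership.Propositional using (_∈_)
open import Data.List.Relation.Unary.Unique.Propositional using (Unique)
open import Data.Product using (Σ; ∃; _×_; _,_)
open import Data.Sum using (_⊎_)
open import Relation.Nullary using (does)
open import Relation.Binary.PropositionalEquality using (_≡_)
open import Function.Bundles using (_⇔_)

-- Keys k_1 < ... < k_n are represented by their indices.
-- A key index  c : Fin n  stands for the key k_{toℕ c + 1}.
-- A gap index  a : Fin (suc n)  stands for the failure interval (k_{toℕ a}, k_{toℕ a + 1}),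
-- with k_0 = -∞ and k_{n+1} = +∞.
-- Only the order of the keys matters, so query values are represented by the
-- atom (key or failure interval) they belong to.

data Item (n : ℕ) : Set where
  key : Fin n → Item n
  gap : Fin (suc n) → Item n

-- position (1-based, as in the paper) of a key
pos : {n : ℕ} → Fin n → ℕ
pos c = suc (toℕ c)

weight : {n : ℕ} → (Fin n → ℚ) → (Fin (suc n) → ℚ) → Item n → ℚ
weight β α (key c) = β c
weight β α (gap a) = α a

-- π is sorted by key weight: β_{π(1)} ≤ ... ≤ β_{π(n)}
-- (π ⟨$⟩ʳ r is the key of (0-based) rank r, i.e. the paper's π(r+1)).
Sorted : {n : ℕ} → (Fin n → ℚ) → Permutation′ n → Set
Sorted β π = ∀ r s → r Fin.≤ s → β (π ⟨$⟩ʳ r) ℚ.≤ β (π ⟨$⟩ʳ s)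

-- Membership in S_{ijh} = [k_i, k_j) \ {k_{π(h+1)}, …, k_{π(n)}, k_0}.
-- A key k_c is in it iff i ≤ c < j and its rank π⁻¹(c) (1-based) is ≤ h.
-- A failure interval (k_a, k_{a+1}) is in it iff i ≤ a and a + 1 ≤ j.
InSijh : {n : ℕ} → Permutation′ n → (i j h : ℕ) → Item n → Set
InSijh π i j h (key c) = (i ℕ.≤ pos c) × (pos c ℕ.< j) × (toℕ (π ⟨$⟩ˡ c) ℕ.< h)
InSijh π i j h (gap a) = (i ℕ.≤ toℕ a) × (suc (toℕ a) ℕ.≤ j)

Valid : {n : ℕ} → Permutation′ n → (Item n → Set) → Set
Valid {n} π S =
  (Σ (Fin n) λ b → ∀ x → S x ⇔ (x ≡ key b))
  ⊎ (Σ ℕ λ i → Σ ℕ λ j → Σ ℕ λ h →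
       (i ℕ.< j) × (j ℕ.≤ suc n) × (h ℕ.≤ n) × (∀ x → S x ⇔ InSijh π i j h x))

data Tree (n : ℕ) : Set where
  leaf : Item n → Tree n
  eqT  : Fin n → Tree n → Tree n → Tree n
  ltT  : Fin n → Tree n → Tree n → Tree n

eqTest : {n : ℕ} → Fin n → Item n → Bool
eqTest c (key d) = does (d Fin.≟ c)
eqTest c (gap a) = false

-- outcome of  q < k_c   (the interval (k_a,k_{a+1}) lies below k_c iff a + 1 ≤ c)
ltTest : {n : ℕ} → Fin n → Item n → Bool
ltTest c (key d) = pos d ℕ.<ᵇ pos c
ltTest c (gap a) = suc (toℕ a) ℕ.≤ᵇ pos c

search : {n : ℕ} → Tree n → Item n → Item n
search (leaf x) q = x
search (eqT c t u) q = if eqTest c q then search t q else search u q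
search (ltT c t u) q = if ltTest c q then search t q else search u q

leaves : {n : ℕ} → Tree n → List (Item n)
leaves (leaf x) = x ∷ []
leaves (eqT c t u) = leaves t ++ leaves u
leaves (ltT c t u) = leaves t ++ leaves u

Handles : {n : ℕ} → Tree n → (Item n → Set) → Set
Handles T S = Unique (leaves T) × (∀ x → x ∈ leaves T ⇔ S x) × (∀ q → S q → search T q ≡ q)

costAt : {n : ℕ} → (Item n → ℚ) → ℕ → Tree n → ℚ
costAt w d (leaf x) = (+ d / 1) ℚ.* w x
costAt w d (eqT c t u) = costAt w (suc d) t ℚ.+ costAt w (suc d) u
costAt w d (ltT c t u) = costAt w (suc d) t ℚ.+ costAt w (suc d) u

cost : {n : ℕ} → (Item n → ℚ) → Tree n → ℚ
cost w T = costAt w 0 T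

IsLeaf : {n : ℕ} → Tree n → Set
IsLeaf {n} T = Σ (Item n) λ x → T ≡ leaf x

RootIsLt : {n : ℕ} → Tree n → Set
RootIsLt {n} T = Σ (Fin n) λ c → Σ (Tree n) λ t → Σ (Tree n) λ u → T ≡ ltT c t u

RootIsEqTo : {n : ℕ} → Fin n → Tree n → Set
RootIsEqTo {n} b T = Σ (Tree n) λ t → Σ (Tree n) λ u → T ≡ eqT b t u

module Submission where

open import Data.Bool using (Bool; true; false; T; not; _∧_; if_then_else_)
open import Data.Bool.Properties using (T-∧; T?; ∧-assoc; ∧-comm; ∧-zeroʳ; ∧-identityʳ)
open import Data.Empty using (⊥-elim)
open import Data.Unit using (tt)
open import Data.Product using (Σ; ∃; _×_; _,_; proj₁; proj₂)
open import Data.Sum using (_⊎_; inj₁; inj₂)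
open import Data.Nat using (ℕ; zero; suc; s≤s; s<s; s≤s⁻¹; s<s⁻¹)
import Data.Nat as ℕ using (_+_; _*_; _≤_; _<_)
import Data.Nat.Properties as ℕ
import Data.Nat.Induction as ℕ
import Data.Nat.Coprimality as Coprime
import Data.Integer as ℤ
import Data.Integer.Properties as ℤ
open import Data.Rational as ℚ using (ℚ; 0ℚ; 1ℚ; mkℚ; _/_; _+_; _*_; _≤_)
import Data.Rational.Properties as ℚ
open import Data.Rational.Solver using (module +-*-Solver)
open import Data.Fin as Fin using (Fin; toℕ)
import Data.Fin.Properties as Fin
open import Data.Fin.Permutation using (Permutation′; _⟨$⟩ˡ_)
open import Data.List using (List; []; _∷_; _++_; map; cartesianProduct; allFin)
open import Data.List.Membership.Propositional using (_∈_; lose)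
open import Data.List.Membership.Propositional.Properties
  using (∈-++⁺ˡ; ∈-++⁺ʳ; ∈-++⁻; ∈-map⁺; ∈-cartesianProduct⁺; ∈-allFin)
open import Data.List.Relation.Unary.Any using (here; there)
import Data.List.Relation.Unary.All as All
import Data.List.Relation.Unary.All.Properties as All
open import Data.List.Relation.Unary.AllPairs using ([]; _∷_)
open import Data.List.Relation.Unary.Unique.Propositional using (Unique)
import Data.List.Relation.Unary.Unique.Propositional.Properties as Unique
open import Data.List.Relation.Binary.Disjoint.Propositional using (Disjoint)
open import Relation.Binary.Bundles using (DecTotalOrder)
open import Data.List.Extrema (DecTotalOrder.totalOrder ℚ.≤-decTotalOrder) using (argmin; argmin-all; f[argmin]≤v⁺)
open import Algebra.Bundles using (CommutativeMonoid)
open import Algebra.Properties.CommutativeSemigroup (CommutativeMonoid.commutativeSemigroup ℚ.+-0-commutativeMonoid)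
  using (interchange; x∙yz≈y∙xz)
open import Function using (_∘_; _$_)
open import Function.Bundles using (_⇔_; mk⇔; Equivalence)
import Function.Properties.Equivalence as ⇔
open import Induction.WellFounded as WF using ()
open import Level using (0ℓ)
import Relation.Binary.Construct.On as On
open import Relation.Binary.Definitions using (DecidableEquality; tri<; tri≈; tri>)
open import Relation.Binary.PropositionalEquality
  using (_≡_; _≢_; refl; sym; trans; cong; cong₂; subst; subst₂; _≗_; module ≡-Reasoning)
open import Relation.Nullary using (¬_; Dec; yes; no; does; map′; _×-dec_)

open import Defs

-- Induction on the number of atoms of the set A.  Take an optimal tree for A whose root
-- tests q = k_a for a key a ≠ b.  Its no-branch u handles A′ = A ∖ {k_a}, and by induction
-- A′ has an optimal tree T₁ whose root compares q < k_c or tests q = k_b.  Since β_a ≤ β_b,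
-- the test for k_a can be moved below the root of T₁ so that the resulting tree for A costs
-- at most W(A) + cost u, which does not exceed the cost of the original tree.  The delicate
-- case is a root q < k_c with k_a and k_b on the same side: optimising that side by
-- induction cuts A′ by two comparisons into intervals X < Y < Z.  If X or Z weighs at
-- least β_a, nesting the two comparisons makes the test for k_a unnecessary; otherwise k_a
-- and k_b both lie in Y, and one more use of induction, on Y, supplies the required root.

private
  T-not⁺ : ∀ {b} → ¬ T b → T (not b)
  T-not⁺ {false} _ = tt
  T-not⁺ {true} ¬b = ¬b tt

  T-not⁻ : ∀ {b} → T (not b) → ¬ T b
  T-not⁻ {false} _ ()

  T-does⁺ : ∀ {P : Set} (p? : Dec P) → P → T (does p?)
  T-does⁺ (yes _) _ = tt
  T-does⁺ (no ¬p) p = ¬p p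

  T-does⁻ : ∀ {P : Set} (p? : Dec P) → T (does p?) → P
  T-does⁻ (yes p) _ = p

  if-T : ∀ {A : Set} {b} {x y : A} → T b → (if b then x else y) ≡ x
  if-T {b = true} _ = refl

  if-¬T : ∀ {A : Set} {b} {x y : A} → ¬ T b → (if b then x else y) ≡ y
  if-¬T {b = false} _ = refl
  if-¬T {b = true} ¬b = ⊥-elim (¬b tt)

  ∧-absorb : ∀ a b c → (T b → T c) → (a ∧ b) ∧ c ≡ a ∧ b
  ∧-absorb a false c _ = trans (cong (_∧ c) (∧-zeroʳ a)) (sym (∧-zeroʳ a))
  ∧-absorb a true true _ = ∧-identityʳ (a ∧ true)
  ∧-absorb a true false b⇒c = ⊥-elim (b⇒c tt)

-- Boolean-valued sets

BoolSet : Set → Set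
BoolSet X = X → Bool

module _ {X : Set} where

  infix 4 _∈ˢ_ _⊆ˢ_
  infixl 7 _∩_ _∖_

  record _∈ˢ_ (x : X) (A : BoolSet X) : Set where
    constructor member
    field isMember : T (A x)

  open _∈ˢ_ public

  _⊆ˢ_ : BoolSet X → BoolSet X → Set
  A ⊆ˢ B = ∀ {x} → x ∈ˢ A → x ∈ˢ B

  -- Abstract, so that the operands of _∩_ and ∁ can be inferred from membership types.
  abstract
    _∩_ : BoolSet X → BoolSet X → BoolSet X
    (A ∩ p) x = A x ∧ p x

    ∁ : BoolSet X → BoolSet X
    ∁ p x = not (p x)

    ∩⁺ : ∀ {x A p} → x ∈ˢ A → x ∈ˢ p → x ∈ˢ A ∩ p
    ∩⁺ (member x∈A) (member x∈p) = member (Equivalence.from T-∧ (x∈A , x∈p))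

    ∩⁻ˡ : ∀ {x A p} → x ∈ˢ A ∩ p → x ∈ˢ A
    ∩⁻ˡ (member h) = member (proj₁ (Equivalence.to T-∧ h))

    ∩⁻ʳ : ∀ {x A p} → x ∈ˢ A ∩ p → x ∈ˢ p
    ∩⁻ʳ (member h) = member (proj₂ (Equivalence.to T-∧ h))

    ∁⁺ : ∀ {x p} → ¬ x ∈ˢ p → x ∈ˢ ∁ p
    ∁⁺ x∉p = member (T-not⁺ (x∉p ∘ member))

    ∁⁻ : ∀ {x p} → x ∈ˢ ∁ p → ¬ x ∈ˢ p
    ∁⁻ (member h) (member h′) = T-not⁻ h h′

    ∩-congˡ : ∀ {A B p} → A ≗ B → A ∩ p ≗ B ∩ p
    ∩-congˡ {p = p} A≗B x = cong (_∧ p x) (A≗B x)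

    ∩-swap : ∀ {A p q} → (A ∩ p) ∩ q ≗ (A ∩ q) ∩ p
    ∩-swap {A} {p} {q} x = begin
      (A x ∧ p x) ∧ q x  ≡⟨ ∧-assoc (A x) (p x) (q x) ⟩
      A x ∧ (p x ∧ q x)  ≡⟨ cong (A x ∧_) (∧-comm (p x) (q x)) ⟩
      A x ∧ (q x ∧ p x)  ≡⟨ ∧-assoc (A x) (q x) (p x) ⟨
      (A x ∧ q x) ∧ p x  ∎
      where open ≡-Reasoning

    ∩-absorb : ∀ {A p q} → p ⊆ˢ q → (A ∩ p) ∩ q ≗ A ∩ p
    ∩-absorb {A} {p} {q} p⊆q x = ∧-absorb (A x) (p x) (q x) (isMember ∘ p⊆q ∘ member)

  _∖_ : BoolSet X → BoolSet X → BoolSet X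
  A ∖ p = A ∩ ∁ p

  NonEmpty : BoolSet X → Set
  NonEmpty A = ∃ (_∈ˢ A)

  _∈ˢ?_ : ∀ x A → Dec (x ∈ˢ A)
  x ∈ˢ? A = map′ member isMember (T? (A x))

  ∈-or-∈∁ : ∀ x p → x ∈ˢ p ⊎ x ∈ˢ ∁ p
  ∈-or-∈∁ x p with x ∈ˢ? p
  ... | yes x∈p = inj₁ x∈p
  ... | no x∉p = inj₂ (∁⁺ x∉p)

  ∈-≗ : ∀ {x A B} → A ≗ B → x ∈ˢ A → x ∈ˢ B
  ∈-≗ {x} A≗B (member h) = member (subst T (A≗B x) h)

  ∁-anti : ∀ {p q} → p ⊆ˢ q → ∁ q ⊆ˢ ∁ p
  ∁-anti p⊆q x∈∁q = ∁⁺ (∁⁻ x∈∁q ∘ p⊆q)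

  ∩-absorb′ : ∀ {A p q} → p ⊆ˢ q → (A ∩ q) ∩ p ≗ A ∩ p
  ∩-absorb′ {A} {p} {q} p⊆q x = trans (∩-swap {A = A} {q} {p} x) (∩-absorb {A = A} p⊆q x)

  ∖-absorb : ∀ {A p q} → p ⊆ˢ q → (A ∖ p) ∖ q ≗ A ∖ q
  ∖-absorb p⊆q = ∩-absorb′ (∁-anti p⊆q)

  decidable-set : ∀ {S P : X → Set} → (∀ x → Dec (P x)) → (∀ x → S x ⇔ P x) →
                  Σ (BoolSet X) λ A → ∀ x → S x ⇔ x ∈ˢ A
  decidable-set P? S⇔P = does ∘ P? , λ x → ⇔.trans (S⇔P x) (mk⇔ (member ∘ T-does⁺ (P? x)) (T-does⁻ (P? x) ∘ isMember))

ItemSet : ℕ → Set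
ItemSet n = BoolSet (Item n)

module _ {n : ℕ} where

  key-injective : ∀ {c d : Fin n} → key c ≡ key d → c ≡ d
  key-injective refl = refl

  gap-injective : ∀ {a a′ : Fin (suc n)} → gap {n} a ≡ gap a′ → a ≡ a′
  gap-injective refl = refl

  infix 4 _≟ᴵ_
  _≟ᴵ_ : DecidableEquality (Item n)
  key c ≟ᴵ key d = map′ (cong key) key-injective (c Fin.≟ d)
  key c ≟ᴵ gap a = no λ ()
  gap a ≟ᴵ key d = no λ ()
  gap a ≟ᴵ gap a′ = map′ (cong gap) gap-injective (a Fin.≟ a′)

  ⦅_⦆ : Item n → ItemSet n
  ⦅ x ⦆ y = does (y ≟ᴵ x)

  ⦅⦆-self : ∀ x → x ∈ˢ ⦅ x ⦆
  ⦅⦆-self x = member (T-does⁺ (x ≟ᴵ x) refl)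

  ⦅⦆⁻ : ∀ {x y} → y ∈ˢ ⦅ x ⦆ → y ≡ x
  ⦅⦆⁻ {x} {y} (member h) = T-does⁻ (y ≟ᴵ x) h

  ⦅⦆-∁ : ∀ {x y} → y ≢ x → y ∈ˢ ∁ ⦅ x ⦆
  ⦅⦆-∁ y≢x = ∁⁺ (y≢x ∘ ⦅⦆⁻)

  ∖⦅⦆-≢ : ∀ {A x y} → y ∈ˢ A ∖ ⦅ x ⦆ → y ≢ x
  ∖⦅⦆-≢ {x = x} y∈ y≡x = ∁⁻ (∩⁻ʳ y∈) (subst (_∈ˢ ⦅ x ⦆) (sym y≡x) (⦅⦆-self x))

  ∖⦅⦆-empty : ∀ {A x y} → ¬ NonEmpty (A ∖ ⦅ x ⦆) → y ∈ˢ A → y ≡ x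
  ∖⦅⦆-empty {x = x} {y} no-other y∈A with ∈-or-∈∁ y ⦅ x ⦆
  ... | inj₁ y∈x = ⦅⦆⁻ y∈x
  ... | inj₂ y∉x = ⊥-elim (no-other (y , ∩⁺ y∈A y∉x))

  eqTest-self : ∀ (d : Fin n) → key d ∈ˢ eqTest d
  eqTest-self d = member (T-does⁺ (d Fin.≟ d) refl)

  eqTest⁻ : ∀ {d : Fin n} {x} → x ∈ˢ eqTest d → x ≡ key d
  eqTest⁻ {d} {key c} (member h) = cong key (T-does⁻ (c Fin.≟ d) h)

  eqTest-∁ : ∀ {d : Fin n} {x} → x ≢ key d → x ∈ˢ ∁ (eqTest d)
  eqTest-∁ x≢d = ∁⁺ (x≢d ∘ eqTest⁻)

  eqTest-⊆ : ∀ {d : Fin n} {p} → key d ∈ˢ p → eqTest d ⊆ˢ p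
  eqTest-⊆ d∈p x∈d = subst (_∈ˢ _) (sym (eqTest⁻ x∈d)) d∈p

  ⊆-∁eqTest : ∀ {d : Fin n} {p} → key d ∈ˢ ∁ p → p ⊆ˢ ∁ (eqTest d)
  ⊆-∁eqTest d∉p x∈p = ∁⁺ λ x∈d → ∁⁻ d∉p (subst (_∈ˢ _) (eqTest⁻ x∈d) x∈p)

  ltTest-key : ∀ {c d : Fin n} → key d ∈ˢ ltTest c ⇔ d Fin.< c
  ltTest-key {c} {d} =
    mk⇔ (λ (member h) → s<s⁻¹ (ℕ.<ᵇ⇒< (pos d) (pos c) h)) (λ d<c → member (ℕ.<⇒<ᵇ (s<s d<c)))

  ltTest-gap : ∀ {c : Fin n} {a} → gap a ∈ˢ ltTest c ⇔ toℕ a ℕ.≤ toℕ c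
  ltTest-gap {c} {a} =
    mk⇔ (λ (member h) → s≤s⁻¹ (ℕ.≤ᵇ⇒≤ (suc (toℕ a)) (pos c) h)) (λ a≤c → member (ℕ.≤⇒≤ᵇ (s≤s a≤c)))

  ltTest-mono : ∀ {c c′ : Fin n} → c Fin.≤ c′ → ltTest c ⊆ˢ ltTest c′
  ltTest-mono c≤c′ {key d} d<c = Equivalence.from ltTest-key (ℕ.<-≤-trans (Equivalence.to ltTest-key d<c) c≤c′)
  ltTest-mono c≤c′ {gap a} a≤c = Equivalence.from ltTest-gap (ℕ.≤-trans (Equivalence.to ltTest-gap a≤c) c≤c′)

  ltTest-between : ∀ {c c′ : Fin n} {x} → x ∈ˢ ∁ (ltTest c) → x ∈ˢ ltTest c′ → c Fin.≤ c′
  ltTest-between {x = key d} d≥c d<c′ =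
    ℕ.<⇒≤ (ℕ.≤-<-trans (ℕ.≮⇒≥ (∁⁻ d≥c ∘ Equivalence.from ltTest-key)) (Equivalence.to ltTest-key d<c′))
  ltTest-between {x = gap a} a>c a≤c′ =
    ℕ.<⇒≤ (ℕ.<-≤-trans (ℕ.≰⇒> (∁⁻ a>c ∘ Equivalence.from ltTest-gap)) (Equivalence.to ltTest-gap a≤c′))

  gaps-separated : ∀ {a a′ : Fin (suc n)} → toℕ a ℕ.< toℕ a′ →
                   Σ (Fin n) λ c → gap a ∈ˢ ltTest c × gap a′ ∈ˢ ∁ (ltTest c)
  gaps-separated {a′ = Fin.suc c} a<a′ =
    c , Equivalence.from ltTest-gap (s≤s⁻¹ a<a′) , ∁⁺ (ℕ.n≮n (toℕ c) ∘ Equivalence.to ltTest-gap)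

  nonEmpty? : ∀ (A : ItemSet n) → Dec (NonEmpty A)
  nonEmpty? A with Fin.any? (λ c → key c ∈ˢ? A) | Fin.any? (λ a → gap a ∈ˢ? A)
  ... | yes (c , c∈A) | _ = yes (key c , c∈A)
  ... | no _ | yes (a , a∈A) = yes (gap a , a∈A)
  ... | no no-key | no no-gap = no λ { (key c , c∈A) → no-key (c , c∈A) ; (gap a , a∈A) → no-gap (a , a∈A) }

module ItemSum {n : ℕ} (M : CommutativeMonoid 0ℓ 0ℓ) (f : Item n → CommutativeMonoid.Carrier M) where

  open CommutativeMonoid M
    using (Carrier; _≈_; _∙_; ε; setoid; ∙-cong; ∙-congˡ; identityˡ; identityʳ; commutativeSemigroup)
    renaming (sym to ≈-sym; reflexive to ≈-reflexive)
  open import Algebra.Properties.CommutativeMonoid.Sum M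
    using (sum; sum-cong-≋; sum-cong-≗; sum-remove; ∑-distrib-+; sum-replicate-zero)
  open import Algebra.Properties.CommutativeSemigroup commutativeSemigroup using () renaming (interchange to ∙-interchange)
  open import Relation.Binary.Reasoning.Setoid setoid

  restrict : ItemSet n → Item n → Carrier
  restrict A x = if A x then f x else ε

  restrict-∈ : ∀ {A x} → x ∈ˢ A → restrict A x ≡ f x
  restrict-∈ {A} {x} (member h) with A x
  ... | true = refl

  restrict-∉ : ∀ {A x} → ¬ x ∈ˢ A → restrict A x ≡ ε
  restrict-∉ {A} {x} x∉A with A x | member {x = x} {A}
  ... | true | mk = ⊥-elim (x∉A (mk tt))
  ... | false | _ = refl

  restrict-split : ∀ A p x → restrict A x ≈ restrict (A ∩ p) x ∙ restrict (A ∖ p) x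
  restrict-split A p x with x ∈ˢ? A | ∈-or-∈∁ x p
  ... | no x∉A | _ = begin
    restrict A x                               ≡⟨ restrict-∉ x∉A ⟩
    ε                                          ≈⟨ identityʳ ε ⟨
    ε ∙ ε                                      ≡⟨ cong₂ _∙_ (restrict-∉ (x∉A ∘ ∩⁻ˡ)) (restrict-∉ (x∉A ∘ ∩⁻ˡ)) ⟨
    restrict (A ∩ p) x ∙ restrict (A ∖ p) x    ∎
  ... | yes x∈A | inj₁ x∈p = begin
    restrict A x                               ≡⟨ restrict-∈ x∈A ⟩
    f x                                        ≈⟨ identityʳ (f x) ⟨
    f x ∙ ε                                    ≡⟨ cong₂ _∙_ (restrict-∈ (∩⁺ x∈A x∈p)) (restrict-∉ (λ x∈ → ∁⁻ (∩⁻ʳ x∈) x∈p)) ⟨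
    restrict (A ∩ p) x ∙ restrict (A ∖ p) x    ∎
  ... | yes x∈A | inj₂ x∉p = begin
    restrict A x                               ≡⟨ restrict-∈ x∈A ⟩
    f x                                        ≈⟨ identityˡ (f x) ⟨
    ε ∙ f x                                    ≡⟨ cong₂ _∙_ (restrict-∉ (λ x∈ → ∁⁻ x∉p (∩⁻ʳ x∈))) (restrict-∈ (∩⁺ x∈A x∉p)) ⟨
    restrict (A ∩ p) x ∙ restrict (A ∖ p) x    ∎

  sum-zero : ∀ {m} (g : Fin m → Carrier) → (∀ j → g j ≈ ε) → sum g ≈ ε
  sum-zero {m} g g≈ε = begin
    sum g               ≈⟨ sum-cong-≋ g≈ε ⟩
    sum {m} (λ _ → ε)   ≈⟨ sum-replicate-zero m ⟩
    ε                   ∎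

  sum-single : ∀ {m} (g : Fin m → Carrier) i → (∀ j → j ≢ i → g j ≈ ε) → sum g ≈ g i
  sum-single {suc m} g i g≈ε = begin
    sum g                          ≈⟨ sum-remove {i = i} g ⟩
    g i ∙ sum (g ∘ Fin.punchIn i)  ≈⟨ ∙-congˡ (sum-zero _ (λ j → g≈ε _ (Fin.punchInᵢ≢i i j))) ⟩
    g i ∙ ε                        ≈⟨ identityʳ (g i) ⟩
    g i                            ∎

  total : ItemSet n → Carrier
  total A = sum (restrict A ∘ key) ∙ sum (restrict A ∘ gap)

  total-cong : ∀ {A B} → A ≗ B → total A ≡ total B
  total-cong {A} {B} A≗B = cong₂ _∙_ (sum-cong-≗ (restrict-cong ∘ key)) (sum-cong-≗ (restrict-cong ∘ gap))
    where
    restrict-cong : restrict A ≗ restrict B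
    restrict-cong x = cong (λ b → if b then f x else ε) (A≗B x)

  total-split : ∀ A p → total A ≈ total (A ∩ p) ∙ total (A ∖ p)
  total-split A p = begin
    sum (restrict A ∘ key) ∙ sum (restrict A ∘ gap)
      ≈⟨ ∙-cong (split-sum key) (split-sum gap) ⟩
    (sum (restrict (A ∩ p) ∘ key) ∙ sum (restrict (A ∖ p) ∘ key)) ∙ (sum (restrict (A ∩ p) ∘ gap) ∙ sum (restrict (A ∖ p) ∘ gap))
      ≈⟨ ∙-interchange _ _ _ _ ⟩
    total (A ∩ p) ∙ total (A ∖ p)
      ∎
    where
    split-sum : ∀ {m} (i : Fin m → Item n) → sum (restrict A ∘ i) ≈ sum (restrict (A ∩ p) ∘ i) ∙ sum (restrict (A ∖ p) ∘ i)
    split-sum i = begin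
      sum (restrict A ∘ i)                                           ≈⟨ sum-cong-≋ (restrict-split A p ∘ i) ⟩
      sum (λ j → restrict (A ∩ p) (i j) ∙ restrict (A ∖ p) (i j))    ≈⟨ ∑-distrib-+ (restrict (A ∩ p) ∘ i) (restrict (A ∖ p) ∘ i) ⟩
      sum (restrict (A ∩ p) ∘ i) ∙ sum (restrict (A ∖ p) ∘ i)        ∎

  total-unique : ∀ {A x} → x ∈ˢ A → (∀ {y} → y ∈ˢ A → y ≡ x) → total A ≈ f x
  total-unique {A} {key d} x∈A unique = begin
    sum (restrict A ∘ key) ∙ sum (restrict A ∘ gap)
      ≈⟨ ∙-cong (sum-single (restrict A ∘ key) d (λ c c≢d → ≈-reflexive (restrict-∉ (c≢d ∘ key-injective ∘ unique))))
                (sum-zero (restrict A ∘ gap) (λ a → ≈-reflexive (restrict-∉ (λ a∈A → key≢gap (sym (unique a∈A)))))) ⟩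
    restrict A (key d) ∙ ε  ≈⟨ identityʳ _ ⟩
    restrict A (key d)      ≡⟨ restrict-∈ x∈A ⟩
    f (key d)               ∎
    where
    key≢gap : ∀ {c a} → key {n} c ≢ gap a
    key≢gap ()
  total-unique {A} {gap a} x∈A unique = begin
    sum (restrict A ∘ key) ∙ sum (restrict A ∘ gap)
      ≈⟨ ∙-cong (sum-zero (restrict A ∘ key) (λ c → ≈-reflexive (restrict-∉ (λ c∈A → gap≢key (sym (unique c∈A))))))
                (sum-single (restrict A ∘ gap) a (λ a′ a′≢a → ≈-reflexive (restrict-∉ (a′≢a ∘ gap-injective ∘ unique)))) ⟩
    ε ∙ restrict A (gap a)  ≈⟨ identityˡ _ ⟩
    restrict A (gap a)      ≡⟨ restrict-∈ x∈A ⟩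
    f (gap a)               ∎
    where
    gap≢key : ∀ {c a} → gap {n} a ≢ key c
    gap≢key ()

module _ {n : ℕ} where

  open ItemSum {n} ℕ.+-0-commutativeMonoid (λ _ → 1) public
    using () renaming (total to size; total-split to size-split)
  open ItemSum {n} ℕ.+-0-commutativeMonoid (λ _ → 1) using (total-unique)

  size-∈ : ∀ {A : ItemSet n} {x} → x ∈ˢ A → 1 ℕ.≤ size A
  size-∈ {A} {x} x∈A = begin
    1                                       ≡⟨ total-unique (∩⁺ x∈A (⦅⦆-self x)) (⦅⦆⁻ ∘ ∩⁻ʳ) ⟨
    size (A ∩ ⦅ x ⦆)                         ≤⟨ ℕ.m≤m+n _ _ ⟩
    size (A ∩ ⦅ x ⦆) ℕ.+ size (A ∖ ⦅ x ⦆)    ≡⟨ size-split A ⦅ x ⦆ ⟨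
    size A                                  ∎
    where open ℕ.≤-Reasoning

  ∩-size-≤ : ∀ (A τ : ItemSet n) → size (A ∩ τ) ℕ.≤ size A
  ∩-size-≤ A τ = ℕ.≤-trans (ℕ.m≤m+n _ _) (ℕ.≤-reflexive (sym (size-split A τ)))

  ∩-smaller : ∀ {A τ : ItemSet n} → NonEmpty (A ∖ τ) → size (A ∩ τ) ℕ.< size A
  ∩-smaller {A} {τ} (_ , x∈) = begin-strict
    size (A ∩ τ)                     <⟨ ℕ.m<m+n _ (size-∈ x∈) ⟩
    size (A ∩ τ) ℕ.+ size (A ∖ τ)    ≡⟨ size-split A τ ⟨
    size A                           ∎
    where open ℕ.≤-Reasoning

  ∖-smaller : ∀ {A τ : ItemSet n} → NonEmpty (A ∩ τ) → size (A ∖ τ) ℕ.< size A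
  ∖-smaller {A} {τ} (_ , x∈) = begin-strict
    size (A ∖ τ)                     <⟨ ℕ.m<n+m _ (size-∈ x∈) ⟩
    size (A ∩ τ) ℕ.+ size (A ∖ τ)    ≡⟨ size-split A τ ⟨
    size A                           ∎
    where open ℕ.≤-Reasoning

-- Trees and the sets they handle

Unique-++⁻ : ∀ {A : Set} (xs : List A) {ys} → Unique (xs ++ ys) → Unique xs × Unique ys × Disjoint xs ys
Unique-++⁻ [] uniq = [] , uniq , λ ()
Unique-++⁻ (x ∷ xs) (x∉ ∷ uniq) with Unique-++⁻ xs uniq | All.++⁻ xs x∉
... | uxs , uys , disj | x∉xs , x∉ys = (x∉xs ∷ uxs) , uys , disj′
  where
  disj′ : Disjoint (x ∷ xs) _
  disj′ (here refl , v∈ys) = All.lookup x∉ys v∈ys refl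
  disj′ (there v∈xs , v∈ys) = disj (v∈xs , v∈ys)

data Kind : Set where
  eqK ltK : Kind

module _ {n : ℕ} where

  test : Kind → Fin n → ItemSet n
  test eqK = eqTest
  test ltK = ltTest

  node : Kind → Fin n → Tree n → Tree n → Tree n
  node eqK = eqT
  node ltK = ltT

  search-node : ∀ k c t u q → search (node k c t u) q ≡ (if test k c q then search t q else search u q)
  search-node eqK c t u q = refl
  search-node ltK c t u q = refl

  leaves-node : ∀ k c t u → leaves (node k c t u) ≡ leaves t ++ leaves u
  leaves-node eqK c t u = refl
  leaves-node ltK c t u = refl

  module _ {k : Kind} {c : Fin n} {t u : Tree n} {q : Item n} where

    search-node-∈ : q ∈ˢ test k c → search (node k c t u) q ≡ search t q
    search-node-∈ (member h) = trans (search-node k c t u q) (if-T h)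

    search-node-∉ : q ∈ˢ ∁ (test k c) → search (node k c t u) q ≡ search u q
    search-node-∉ q∉τ = trans (search-node k c t u q) (if-¬T (∁⁻ q∉τ ∘ member))

  search-∈-leaves : ∀ (t : Tree n) q → search t q ∈ leaves t
  search-∈-leaves (leaf x) q = here refl
  search-∈-leaves (eqT c t u) q with eqTest c q
  ... | true = ∈-++⁺ˡ (search-∈-leaves t q)
  ... | false = ∈-++⁺ʳ (leaves t) (search-∈-leaves u q)
  search-∈-leaves (ltT c t u) q with ltTest c q
  ... | true = ∈-++⁺ˡ (search-∈-leaves t q)
  ... | false = ∈-++⁺ʳ (leaves t) (search-∈-leaves u q)

  Handles-⇔ : ∀ {T : Tree n} {S S′ : Item n → Set} → (∀ x → S x ⇔ S′ x) → Handles T S → Handles T S′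
  Handles-⇔ S⇔S′ (uniq , ∈⇔ , found) =
    uniq , (λ x → ⇔.trans (∈⇔ x) (S⇔S′ x)) , λ q q∈S′ → found q (Equivalence.from (S⇔S′ q) q∈S′)

  infix 4 _handles_
  record _handles_ (T : Tree n) (A : ItemSet n) : Set where
    constructor mkHandles
    field handles : Handles T (_∈ˢ A)

  Handles⇔handles : ∀ {T S A} → (∀ x → S x ⇔ x ∈ˢ A) → Handles T S ⇔ T handles A
  Handles⇔handles {T} S⇔A = mk⇔ (mkHandles ∘ Handles-⇔ {T = T} S⇔A) (Handles-⇔ {T = T} (⇔.sym ∘ S⇔A) ∘ _handles_.handles)

  handles-cong : ∀ {T A B} → A ≗ B → T handles A → T handles B
  handles-cong {T} A≗B (mkHandles h) = mkHandles (Handles-⇔ {T = T} (λ x → mk⇔ (∈-≗ A≗B) (∈-≗ (sym ∘ A≗B))) h)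

  handles-nonEmpty : ∀ {T A} → T handles A → NonEmpty A
  handles-nonEmpty {T} (mkHandles (_ , ∈⇔ , _)) = search T q , Equivalence.to (∈⇔ _) (search-∈-leaves T q)
    where q = gap Fin.zero

  leaf-handles⁺ : ∀ {x A} → x ∈ˢ A → (∀ {y} → y ∈ˢ A → y ≡ x) → leaf x handles A
  leaf-handles⁺ {x} x∈A unique = mkHandles $
    (All.[] ∷ []) , (λ y → mk⇔ (λ { (here refl) → x∈A ; (there ()) }) (here ∘ unique)) , λ q → sym ∘ unique

  leaf-handles⁻ : ∀ {x A} → leaf x handles A → x ∈ˢ A × (∀ {y} → y ∈ˢ A → y ≡ x)
  leaf-handles⁻ (mkHandles (_ , ∈⇔ , _)) =
    Equivalence.to (∈⇔ _) (here refl) , λ y∈A → ∈-single (Equivalence.from (∈⇔ _) y∈A)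
    where
    ∈-single : ∀ {x y : Item n} → y ∈ x ∷ [] → y ≡ x
    ∈-single (here y≡x) = y≡x

  node-handles⁺ : ∀ {k c t u A} → t handles A ∩ test k c → u handles A ∖ test k c → node k c t u handles A
  node-handles⁺ {k} {c} {t} {u} {A} (mkHandles (uniq-t , ∈t , found-t)) (mkHandles (uniq-u , ∈u , found-u)) = mkHandles $
    subst Unique (sym (leaves-node k c t u)) (Unique.++⁺ uniq-t uniq-u disjoint) ,
    (λ x → mk⇔ (to ∘ subst (x ∈_) (leaves-node k c t u)) (subst (x ∈_) (sym (leaves-node k c t u)) ∘ from)) ,
    found
    where
    τ = test k c
    disjoint : Disjoint (leaves t) (leaves u)
    disjoint (x∈t , x∈u) = ∁⁻ (∩⁻ʳ (Equivalence.to (∈u _) x∈u)) (∩⁻ʳ (Equivalence.to (∈t _) x∈t))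
    to : ∀ {x} → x ∈ leaves t ++ leaves u → x ∈ˢ A
    to x∈ with ∈-++⁻ (leaves t) x∈
    ... | inj₁ x∈t = ∩⁻ˡ (Equivalence.to (∈t _) x∈t)
    ... | inj₂ x∈u = ∩⁻ˡ (Equivalence.to (∈u _) x∈u)
    from : ∀ {x} → x ∈ˢ A → x ∈ leaves t ++ leaves u
    from {x} x∈A with ∈-or-∈∁ x τ
    ... | inj₁ x∈τ = ∈-++⁺ˡ (Equivalence.from (∈t x) (∩⁺ x∈A x∈τ))
    ... | inj₂ x∉τ = ∈-++⁺ʳ (leaves t) (Equivalence.from (∈u x) (∩⁺ x∈A x∉τ))
    found : ∀ q → q ∈ˢ A → search (node k c t u) q ≡ q
    found q q∈A with ∈-or-∈∁ q τ
    ... | inj₁ q∈τ = trans (search-node-∈ {k} {c} {t} {u} q∈τ) (found-t q (∩⁺ q∈A q∈τ))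
    ... | inj₂ q∉τ = trans (search-node-∉ {k} {c} {t} {u} q∉τ) (found-u q (∩⁺ q∈A q∉τ))

  node-handles⁻ : ∀ {k c t u A} → node k c t u handles A → t handles A ∩ test k c × u handles A ∖ test k c
  node-handles⁻ {k} {c} {t} {u} {A} (mkHandles (uniq , ∈node , found)) =
    mkHandles (uniq-t , ∈t , found-t) , mkHandles (uniq-u , ∈u , found-u)
    where
    τ = test k c
    split = Unique-++⁻ (leaves t) (subst Unique (leaves-node k c t u) uniq)
    uniq-t = proj₁ split
    uniq-u = proj₁ (proj₂ split)
    disjoint = proj₂ (proj₂ split)
    ∈A : ∀ {x} → x ∈ leaves t ++ leaves u → x ∈ˢ A
    ∈A {x} x∈ = Equivalence.to (∈node x) (subst (x ∈_) (sym (leaves-node k c t u)) x∈)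
    found-t : ∀ q → q ∈ˢ A ∩ τ → search t q ≡ q
    found-t q q∈ = trans (sym (search-node-∈ {k} {c} {t} {u} (∩⁻ʳ q∈))) (found q (∩⁻ˡ q∈))
    found-u : ∀ q → q ∈ˢ A ∖ τ → search u q ≡ q
    found-u q q∈ = trans (sym (search-node-∉ {k} {c} {t} {u} (∩⁻ʳ q∈))) (found q (∩⁻ˡ q∈))
    reach-t : ∀ {x} → x ∈ˢ A ∩ τ → x ∈ leaves t
    reach-t {x} x∈ = subst (_∈ leaves t) (found-t x x∈) (search-∈-leaves t x)
    reach-u : ∀ {x} → x ∈ˢ A ∖ τ → x ∈ leaves u
    reach-u {x} x∈ = subst (_∈ leaves u) (found-u x x∈) (search-∈-leaves u x)
    -- a leaf on the wrong side of the test would also be reached in the other subtree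
    t-passes : ∀ {x} → x ∈ leaves t → x ∈ˢ τ
    t-passes {x} x∈t with ∈-or-∈∁ x τ
    ... | inj₁ x∈τ = x∈τ
    ... | inj₂ x∉τ = ⊥-elim (disjoint (x∈t , reach-u (∩⁺ (∈A (∈-++⁺ˡ x∈t)) x∉τ)))
    u-fails : ∀ {x} → x ∈ leaves u → x ∈ˢ ∁ τ
    u-fails {x} x∈u with ∈-or-∈∁ x τ
    ... | inj₁ x∈τ = ⊥-elim (disjoint (reach-t (∩⁺ (∈A (∈-++⁺ʳ (leaves t) x∈u)) x∈τ) , x∈u))
    ... | inj₂ x∉τ = x∉τ
    ∈t : ∀ x → x ∈ leaves t ⇔ x ∈ˢ A ∩ τ
    ∈t x = mk⇔ (λ x∈t → ∩⁺ (∈A (∈-++⁺ˡ x∈t)) (t-passes x∈t)) reach-t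
    ∈u : ∀ x → x ∈ leaves u ⇔ x ∈ˢ A ∖ τ
    ∈u x = mk⇔ (λ x∈u → ∩⁺ (∈A (∈-++⁺ʳ (leaves t) x∈u)) (u-fails x∈u)) reach-u

  lt-handles⁺ : ∀ {c t u A} → t handles A ∩ ltTest c → u handles A ∖ ltTest c → ltT c t u handles A
  lt-handles⁺ {c} = node-handles⁺ {ltK} {c}

  lt-handles⁻ : ∀ {c t u A} → ltT c t u handles A → t handles A ∩ ltTest c × u handles A ∖ ltTest c
  lt-handles⁻ {c} = node-handles⁻ {ltK} {c}

  eq-handles⁻ : ∀ {d t u A} → eqT d t u handles A → t handles A ∩ eqTest d × u handles A ∖ eqTest d
  eq-handles⁻ {d} = node-handles⁻ {eqK} {d}

  eq-handles⇒∈ : ∀ {d t u A} → eqT d t u handles A → key d ∈ˢ A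
  eq-handles⇒∈ {A = A} h with handles-nonEmpty (proj₁ (eq-handles⁻ h))
  ... | _ , x∈ = subst (_∈ˢ A) (eqTest⁻ (∩⁻ʳ x∈)) (∩⁻ˡ x∈)

  peel : Fin n → Tree n → Tree n
  peel d t = eqT d (leaf (key d)) t

  peel-handles : ∀ {d t A} → key d ∈ˢ A → t handles A ∖ eqTest d → peel d t handles A
  peel-handles {d} d∈A ht = node-handles⁺ {eqK} {d} (leaf-handles⁺ (∩⁺ d∈A (eqTest-self d)) (eqTest⁻ ∘ ∩⁻ʳ)) ht

  Splits : ItemSet n → ItemSet n → Set
  Splits A τ = NonEmpty (A ∩ τ) × NonEmpty (A ∖ τ)

  node-splits : ∀ {k c t u A} → node k c t u handles A → Splits A (test k c)
  node-splits h = handles-nonEmpty (proj₁ (node-handles⁻ h)) , handles-nonEmpty (proj₂ (node-handles⁻ h))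

  splitting-test : ∀ {A : ItemSet n} {x y} → x ∈ˢ A → y ∈ˢ A → x ≢ y → Σ Kind λ k → Σ (Fin n) λ c → Splits A (test k c)
  splitting-test {x = key d} x∈A y∈A x≢y = eqK , d , (_ , ∩⁺ x∈A (eqTest-self d)) , (_ , ∩⁺ y∈A (eqTest-∁ (x≢y ∘ sym)))
  splitting-test {x = gap a} {key d} x∈A y∈A _ = eqK , d , (_ , ∩⁺ y∈A (eqTest-self d)) , (_ , ∩⁺ x∈A (eqTest-∁ λ ()))
  splitting-test {x = gap a} {gap a′} x∈A y∈A x≢y with ℕ.<-cmp (toℕ a) (toℕ a′)
  ... | tri< a<a′ _ _ = let c , x∈l , y∉l = gaps-separated a<a′ in ltK , c , (_ , ∩⁺ x∈A x∈l) , (_ , ∩⁺ y∈A y∉l)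
  ... | tri≈ _ a≡a′ _ = ⊥-elim (x≢y (cong gap (Fin.toℕ-injective a≡a′)))
  ... | tri> _ _ a>a′ = let c , y∈l , x∉l = gaps-separated a>a′ in ltK , c , (_ , ∩⁺ y∈A y∈l) , (_ , ∩⁺ x∈A x∉l)

  allTests : List (Kind × Fin n)
  allTests = cartesianProduct (eqK ∷ ltK ∷ []) (allFin n)

  ∈-allTests : ∀ k c → (k , c) ∈ allTests
  ∈-allTests eqK c = ∈-cartesianProduct⁺ {xs = eqK ∷ ltK ∷ []} {ys = allFin n} (here refl) (∈-allFin c)
  ∈-allTests ltK c = ∈-cartesianProduct⁺ {xs = eqK ∷ ltK ∷ []} {ys = allFin n} (there (here refl)) (∈-allFin c)

-- Costs and optimal trees

/1-suc : ∀ d → ℤ.+ suc d / 1 ≡ ℤ.+ d / 1 + 1ℚ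
/1-suc d = begin
  ℤ.+ suc d / 1                                       ≡⟨ ℚ./-cong {q₁ = 1} {q₂ = 1} numerator refl ⟩
  (ℤ.+ d ℤ.* ℤ.+ 1 ℤ.+ ℤ.+ 1 ℤ.* ℤ.+ 1) / (1 ℕ.* 1)   ≡⟨⟩
  mkℚ (ℤ.+ d) 0 d/1-coprime + 1ℚ                      ≡⟨ cong (_+ 1ℚ) (ℚ.normalize-coprime d/1-coprime) ⟨
  ℤ.+ d / 1 + 1ℚ                                      ∎
  where
  open ≡-Reasoning
  numerator = trans (cong ℤ.+_ (ℕ.+-comm 1 d)) (cong (ℤ._+ ℤ.+ 1) (sym (ℤ.*-identityʳ (ℤ.+ d))))
  d/1-coprime = Coprime.sym (Coprime.1-coprimeTo d)

+-cancelˡ-≤ : ∀ r {p q : ℚ} → r + p ≤ r + q → p ≤ q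
+-cancelˡ-≤ r {p} {q} r+p≤r+q = subst₂ _≤_ (cancel p) (cancel q) (ℚ.+-monoʳ-≤ (ℚ.- r) r+p≤r+q)
  where
  cancel : ∀ s → ℚ.- r + (r + s) ≡ s
  cancel s = trans (sym (ℚ.+-assoc (ℚ.- r) r s)) (trans (cong (_+ s) (ℚ.+-inverseˡ r)) (ℚ.+-identityˡ s))

+-trade-≤ : ∀ {p q x y : ℚ} → p + x ≡ q + y → q ≤ p → x ≤ y
+-trade-≤ {p} {q} {x} p+x≡q+y q≤p = +-cancelˡ-≤ q (ℚ.≤-trans (ℚ.+-monoˡ-≤ x q≤p) (ℚ.≤-reflexive p+x≡q+y))

+-≤-dropˡ : ∀ {p q x : ℚ} → 0ℚ ≤ p → p + q ≤ x → q ≤ x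
+-≤-dropˡ {p} {q} 0≤p p+q≤x = ℚ.≤-trans (subst (_≤ p + q) (ℚ.+-identityˡ q) (ℚ.+-monoˡ-≤ q 0≤p)) p+q≤x

module Costs {n : ℕ} (w : Item n → ℚ) (w≥0 : ∀ x → 0ℚ ≤ w x) where

  open ItemSum ℚ.+-0-commutativeMonoid w public
    using (restrict) renaming (total to W; total-cong to W-cong; total-split to W-split; total-unique to W-unique)
  open import Algebra.Properties.CommutativeMonoid.Sum ℚ.+-0-commutativeMonoid using (sum)

  sum-nonNeg : ∀ {m} (g : Fin m → ℚ) → (∀ i → 0ℚ ≤ g i) → 0ℚ ≤ sum g
  sum-nonNeg {zero} g _ = ℚ.≤-refl
  sum-nonNeg {suc m} g g≥0 = ℚ.+-mono-≤ (g≥0 Fin.zero) (sum-nonNeg (g ∘ Fin.suc) (g≥0 ∘ Fin.suc))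

  restrict-nonNeg : ∀ A x → 0ℚ ≤ restrict A x
  restrict-nonNeg A x with A x
  ... | true = w≥0 x
  ... | false = ℚ.≤-refl

  W-nonNeg : ∀ A → 0ℚ ≤ W A
  W-nonNeg A = ℚ.+-mono-≤ (sum-nonNeg _ (restrict-nonNeg A ∘ key)) (sum-nonNeg _ (restrict-nonNeg A ∘ gap))

  W-key : ∀ {A d} → key d ∈ˢ A → W A ≡ w (key d) + W (A ∖ eqTest d)
  W-key {A} {d} d∈A =
    trans (W-split A (eqTest d)) (cong (_+ W (A ∖ eqTest d)) (W-unique (∩⁺ d∈A (eqTest-self d)) (eqTest⁻ ∘ ∩⁻ʳ)))

  W-key-≤ : ∀ {A d} → key d ∈ˢ A → w (key d) ≤ W A
  W-key-≤ {A} {d} d∈A = begin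
    w (key d)                      ≡⟨ ℚ.+-identityʳ (w (key d)) ⟨
    w (key d) + 0ℚ                 ≤⟨ ℚ.+-monoʳ-≤ (w (key d)) (W-nonNeg (A ∖ eqTest d)) ⟩
    w (key d) + W (A ∖ eqTest d)   ≡⟨ W-key d∈A ⟨
    W A                            ∎
    where open ℚ.≤-Reasoning

  costAt-node : ∀ k c t u d → costAt w d (node k c t u) ≡ costAt w (suc d) t + costAt w (suc d) u
  costAt-node eqK c t u d = refl
  costAt-node ltK c t u d = refl

  costAt-suc : ∀ {A} d t → t handles A → costAt w (suc d) t ≡ costAt w d t + W A
  costAt-suc-node : ∀ {A} d k c t u → node k c t u handles A →
                    costAt w (suc d) (node k c t u) ≡ costAt w d (node k c t u) + W A

  costAt-suc {A} d (leaf x) h = begin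
    (ℤ.+ suc d / 1) * w x              ≡⟨ cong (_* w x) (/1-suc d) ⟩
    (ℤ.+ d / 1 + 1ℚ) * w x             ≡⟨ ℚ.*-distribʳ-+ (w x) (ℤ.+ d / 1) 1ℚ ⟩
    (ℤ.+ d / 1) * w x + 1ℚ * w x       ≡⟨ cong ((ℤ.+ d / 1) * w x +_) (trans (ℚ.*-identityˡ (w x)) (sym W-A≡w)) ⟩
    (ℤ.+ d / 1) * w x + W A            ∎
    where
    open ≡-Reasoning
    W-A≡w = W-unique (proj₁ (leaf-handles⁻ h)) (proj₂ (leaf-handles⁻ h))
  costAt-suc d (eqT c t u) = costAt-suc-node d eqK c t u
  costAt-suc d (ltT c t u) = costAt-suc-node d ltK c t u

  costAt-suc-node {A} d k c t u h = begin
    costAt w (suc d) (node k c t u)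
      ≡⟨ costAt-node k c t u (suc d) ⟩
    costAt w (suc (suc d)) t + costAt w (suc (suc d)) u
      ≡⟨ cong₂ _+_ (costAt-suc (suc d) t (proj₁ (node-handles⁻ h))) (costAt-suc (suc d) u (proj₂ (node-handles⁻ h))) ⟩
    (costAt w (suc d) t + W (A ∩ τ)) + (costAt w (suc d) u + W (A ∖ τ))
      ≡⟨ interchange (costAt w (suc d) t) (W (A ∩ τ)) (costAt w (suc d) u) (W (A ∖ τ)) ⟩
    (costAt w (suc d) t + costAt w (suc d) u) + (W (A ∩ τ) + W (A ∖ τ))
      ≡⟨ cong₂ _+_ (costAt-node k c t u d) (W-split A τ) ⟨
    costAt w d (node k c t u) + W A
      ∎
    where
    open ≡-Reasoning
    τ = test k c

  costAt-nonNeg : ∀ d t → 0ℚ ≤ costAt w d t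
  costAt-nonNeg d (leaf x) =
    ℚ.nonNegative⁻¹ _ {{ℚ.nonNeg*nonNeg⇒nonNeg (ℤ.+ d / 1) {{ℚ.normalize-nonNeg d 1}} (w x) {{ℚ.nonNegative (w≥0 x)}}}}
  costAt-nonNeg d (eqT c t u) = ℚ.+-mono-≤ (costAt-nonNeg (suc d) t) (costAt-nonNeg (suc d) u)
  costAt-nonNeg d (ltT c t u) = ℚ.+-mono-≤ (costAt-nonNeg (suc d) t) (costAt-nonNeg (suc d) u)

  cost-nonNeg : ∀ t → 0ℚ ≤ cost w t
  cost-nonNeg = costAt-nonNeg 0

  cost-leaf : ∀ x → cost w (leaf x) ≡ 0ℚ
  cost-leaf x = ℚ.*-zeroˡ (w x)

  cost-node : ∀ {A} k c t u → node k c t u handles A → cost w (node k c t u) ≡ W A + (cost w t + cost w u)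
  cost-node {A} k c t u h = begin
    cost w (node k c t u)                              ≡⟨ costAt-node k c t u 0 ⟩
    costAt w 1 t + costAt w 1 u                        ≡⟨ cong₂ _+_ (costAt-suc 0 t (proj₁ (node-handles⁻ h)))
                                                                    (costAt-suc 0 u (proj₂ (node-handles⁻ h))) ⟩
    (cost w t + W (A ∩ τ)) + (cost w u + W (A ∖ τ))    ≡⟨ solve 4 (λ t a u b → (t :+ a) :+ (u :+ b) := (a :+ b) :+ (t :+ u)) refl
                                                                  (cost w t) (W (A ∩ τ)) (cost w u) (W (A ∖ τ)) ⟩
    (W (A ∩ τ) + W (A ∖ τ)) + (cost w t + cost w u)    ≡⟨ cong (_+ (cost w t + cost w u)) (W-split A τ) ⟨
    W A + (cost w t + cost w u)                        ∎
    where
    open ≡-Reasoning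
    open +-*-Solver
    τ = test k c

  cost-peel : ∀ {A} d t → peel d t handles A → cost w (peel d t) ≡ W A + cost w t
  cost-peel {A} d t h = trans (cost-node eqK d (leaf (key d)) t h)
                              (cong (W A +_) (trans (cong (_+ cost w t) (cost-leaf (key d))) (ℚ.+-identityˡ (cost w t))))

  node-cost-≤ : ∀ {A x} k c t u → node k c t u handles A → cost w t + cost w u ≤ x → cost w (node k c t u) ≤ W A + x
  node-cost-≤ {A} k c t u h ≤x = subst (_≤ _) (sym (cost-node k c t u h)) (ℚ.+-monoʳ-≤ (W A) ≤x)

  peel-cost-≤ : ∀ {A x} d t → peel d t handles A → cost w t ≤ x → cost w (peel d t) ≤ W A + x
  peel-cost-≤ {A} d t h ≤x = subst (_≤ _) (sym (cost-peel d t h)) (ℚ.+-monoʳ-≤ (W A) ≤x)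

  subtrees-≤ : ∀ {A x} k c t u → node k c t u handles A → cost w (node k c t u) ≤ W A + x → cost w t + cost w u ≤ x
  subtrees-≤ {A} k c t u h ≤x = +-cancelˡ-≤ (W A) (subst (_≤ _) (cost-node k c t u h) ≤x)

  right-cost-≤ : ∀ {x} t u → cost w t + cost w u ≤ x → cost w u ≤ x
  right-cost-≤ t u = +-≤-dropˡ (cost-nonNeg t)

  Optimal : ItemSet n → Tree n → Set
  Optimal A T = T handles A × (∀ T′ → T′ handles A → cost w T ≤ cost w T′)

  leaf-optimal : ∀ {A x} → x ∈ˢ A → (∀ {y} → y ∈ˢ A → y ≡ x) → Optimal A (leaf x)
  leaf-optimal {x = x} x∈A unique =
    leaf-handles⁺ x∈A unique , λ T′ _ → subst (_≤ cost w T′) (sym (cost-leaf x)) (cost-nonNeg T′)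

  cheaper-optimal : ∀ {A T₀ T} → Optimal A T₀ → T handles A → cost w T ≤ cost w T₀ → Optimal A T
  cheaper-optimal (_ , T₀-opt) hT T≤T₀ = hT , λ T′ h′ → ℚ.≤-trans T≤T₀ (T₀-opt T′ h′)

  Beats : ItemSet n → Tree n → Kind × Fin n → Set
  Beats A T (k , c) = ∀ t u → node k c t u handles A → cost w T ≤ cost w (node k c t u)

  OptimalBelow : ItemSet n → Set
  OptimalBelow A = ∀ {B} → size B ℕ.< size A → NonEmpty B → Σ (Tree n) (Optimal B)

  best-node : ∀ {A} → OptimalBelow A → ∀ k c → Splits A (test k c) → Σ (Tree n) λ T → T handles A × Beats A T (k , c)
  best-node {A} smaller k c (ne₁ , ne₂) with smaller (∩-smaller ne₂) ne₁ | smaller (∖-smaller ne₁) ne₂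
  ... | t , ht , t-opt | u , hu , u-opt = node k c t u , node-handles⁺ ht hu , beats
    where
    beats : Beats A (node k c t u) (k , c)
    beats t′ u′ h′ = begin
      cost w (node k c t u)          ≡⟨ cost-node k c t u (node-handles⁺ ht hu) ⟩
      W A + (cost w t + cost w u)    ≤⟨ ℚ.+-monoʳ-≤ (W A) (ℚ.+-mono-≤ (t-opt t′ (proj₁ (node-handles⁻ h′)))
                                                                      (u-opt u′ (proj₂ (node-handles⁻ h′)))) ⟩
      W A + (cost w t′ + cost w u′)  ≡⟨ cost-node k c t′ u′ h′ ⟨
      cost w (node k c t′ u′)        ∎
      where open ℚ.≤-Reasoning

  optimal-from-smaller : ∀ {A} → OptimalBelow A → NonEmpty A → Σ (Tree n) (Optimal A)
  optimal-from-smaller {A} smaller (x , x∈A) with nonEmpty? (A ∖ ⦅ x ⦆)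
  ... | no no-other = leaf x , leaf-optimal x∈A (∖⦅⦆-empty no-other)
  ... | yes (y , y∈) = cheapest , handled , optimal
    where
    fallback : Σ (Tree n) (_handles A)
    fallback with splitting-test x∈A (∩⁻ˡ y∈) (∖⦅⦆-≢ y∈ ∘ sym)
    ... | k , c , splits = proj₁ (best-node smaller k c splits) , proj₁ (proj₂ (best-node smaller k c splits))
    candidate : ∀ r → Σ (Tree n) λ T → T handles A × Beats A T r
    candidate (k , c) with nonEmpty? (A ∩ test k c) ×-dec nonEmpty? (A ∖ test k c)
    ... | yes splits = best-node smaller k c splits
    ... | no ¬splits = proj₁ fallback , proj₂ fallback , λ t u h → ⊥-elim (¬splits (node-splits h))
    candidates : List (Tree n)
    candidates = map (proj₁ ∘ candidate) allTests
    cheapest : Tree n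
    cheapest = argmin (cost w) (proj₁ fallback) candidates
    handled : cheapest handles A
    handled = argmin-all (cost w) {P = _handles A} (proj₂ fallback) (All.map⁺ (All.universal (proj₁ ∘ proj₂ ∘ candidate) allTests))
    beaten : ∀ k c t u → node k c t u handles A → cost w cheapest ≤ cost w (node k c t u)
    beaten k c t u h = f[argmin]≤v⁺ {f = cost w} (proj₁ fallback) candidates
      (inj₂ (lose (∈-map⁺ (proj₁ ∘ candidate) (∈-allTests k c)) (proj₂ (proj₂ (candidate (k , c))) t u h)))
    optimal : ∀ T′ → T′ handles A → cost w cheapest ≤ cost w T′
    optimal (leaf z) h = ⊥-elim (∖⦅⦆-≢ y∈ (trans (only (∩⁻ˡ y∈)) (sym (only x∈A))))
      where only = proj₂ (leaf-handles⁻ h)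
    optimal (eqT c t u) = beaten eqK c t u
    optimal (ltT c t u) = beaten ltK c t u

  optimal-exists : ∀ A → NonEmpty A → Σ (Tree n) (Optimal A)
  optimal-exists = WF.All.wfRec (On.wellFounded size ℕ.<-wellFounded) 0ℓ _ λ _ → optimal-from-smaller

-- The exchange argument

module Exchange {n : ℕ} (β : Fin n → ℚ) (α : Fin (suc n) → ℚ)
                (β≥0 : ∀ b → 0ℚ ≤ β b) (α≥0 : ∀ a → 0ℚ ≤ α a) where

  w : Item n → ℚ
  w = weight β α

  w≥0 : ∀ x → 0ℚ ≤ w x
  w≥0 (key c) = β≥0 c
  w≥0 (gap a) = α≥0 a

  open Costs w w≥0 public

  Heaviest : ItemSet n → Fin n → Set
  Heaviest A b = ∀ {c} → key c ∈ˢ A → β c ≤ β b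

  WellRooted : Fin n → Tree n → Set
  WellRooted b T = RootIsLt T ⊎ RootIsEqTo b T

  WellRootedOptimum : ItemSet n → Set
  WellRootedOptimum A = ∀ {b} → key b ∈ˢ A → Heaviest A b → NonEmpty (A ∖ ⦅ key b ⦆) →
                        Σ (Tree n) λ T → Optimal A T × WellRooted b T

  module Step {A : ItemSet n} (smaller : ∀ {B} → size B ℕ.< size A → WellRootedOptimum B)
              {a b : Fin n} (a≢b : a ≢ b) (a∈A : key a ∈ˢ A) (b∈A : key b ∈ˢ A) (heaviest : Heaviest A b) where

    A′ : ItemSet n
    A′ = A ∖ eqTest a

    βa≤βb : β a ≤ β b
    βa≤βb = heaviest a∈A

    W-A′ : W A ≡ β a + W A′
    W-A′ = W-key a∈A

    W-A∖b≤W-A′ : W (A ∖ eqTest b) ≤ W A′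
    W-A∖b≤W-A′ = +-trade-≤ (trans (sym (W-key b∈A)) W-A′) βa≤βb

    ∖-light : ∀ τ → β a ≤ W (A ∩ τ) → W (A ∖ τ) ≤ W A′
    ∖-light τ βa≤ = +-trade-≤ (trans (sym (W-split A τ)) W-A′) βa≤

    ∩-light : ∀ τ → β a ≤ W (A ∖ τ) → W (A ∩ τ) ≤ W A′
    ∩-light τ βa≤ = +-trade-≤ (trans (ℚ.+-comm (W (A ∖ τ)) (W (A ∩ τ))) (trans (sym (W-split A τ)) W-A′)) βa≤

    b∈A′ : key b ∈ˢ A′
    b∈A′ = ∩⁺ b∈A (eqTest-∁ (a≢b ∘ sym ∘ key-injective))

    a∈A∖b : key a ∈ˢ A ∖ eqTest b
    a∈A∖b = ∩⁺ a∈A (eqTest-∁ (a≢b ∘ key-injective))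

    recurse : ∀ {B} → B ⊆ˢ A → size B ℕ.< size A → key b ∈ˢ B → key a ∈ˢ B →
              Σ (Tree n) λ T → Optimal B T × WellRooted b T
    recurse B⊆A B<A b∈B a∈B = smaller B<A b∈B (heaviest ∘ B⊆A) (key a , ∩⁺ a∈B (⦅⦆-∁ (a≢b ∘ key-injective)))

    Within : ℚ → Set
    Within x = Σ (Tree n) λ T → T handles A × WellRooted b T × cost w T ≤ W A + x

    within-≤ : ∀ {x y} → x ≤ y → Within x → Within y
    within-≤ x≤y (T , hT , root , ≤x) = T , hT , root , ℚ.≤-trans ≤x (ℚ.+-monoʳ-≤ (W A) x≤y)

    lt-within : ∀ {c t u x} → ltT c t u handles A → cost w t + cost w u ≤ x → Within x
    lt-within {c} {t} {u} h ≤x = ltT c t u , h , inj₁ (c , t , u , refl) , node-cost-≤ ltK c t u h ≤x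

    peel-within : ∀ {t x} → peel b t handles A → cost w t ≤ x → Within x
    peel-within {t} h ≤x = peel b t , h , inj₂ (leaf (key b) , t , refl) , peel-cost-≤ b t h ≤x

    module ThreeWay {c₁ c₂ : Fin n} (c₁≤c₂ : c₁ Fin.≤ c₂) {tx ty tz : Tree n}
                    (hx : tx handles A ∩ ltTest c₁) (hy : ty handles (A ∖ ltTest c₁) ∩ ltTest c₂)
                    (hz : tz handles A ∖ ltTest c₂) where

      l₁ l₂ : ItemSet n
      l₁ = ltTest c₁
      l₂ = ltTest c₂

      l₁⊆l₂ : l₁ ⊆ˢ l₂
      l₁⊆l₂ = ltTest-mono c₁≤c₂

      Y : ItemSet n
      Y = (A ∖ l₁) ∩ l₂

      -- W A + budget is the cost of testing q = k_a first and then splitting A′ three ways at depth 2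
      budget : ℚ
      budget = W A′ + (cost w tx + (cost w ty + cost w tz))

      low-heavy : β a ≤ W (A ∩ l₁) → Within budget
      low-heavy βa≤ = lt-within h (begin
        cost w tx + cost w rest                             ≡⟨ cong (cost w tx +_) (cost-node ltK c₂ ty tz h-rest) ⟩
        cost w tx + (W (A ∖ l₁) + (cost w ty + cost w tz))  ≤⟨ ℚ.+-monoʳ-≤ (cost w tx) (ℚ.+-monoˡ-≤ _ (∖-light l₁ βa≤)) ⟩
        cost w tx + (W A′ + (cost w ty + cost w tz))        ≡⟨ x∙yz≈y∙xz (cost w tx) (W A′) _ ⟩
        budget                                              ∎)
        where
        open ℚ.≤-Reasoning
        rest = ltT c₂ ty tz
        h-rest : rest handles A ∖ l₁
        h-rest = lt-handles⁺ hy (handles-cong (sym ∘ ∖-absorb l₁⊆l₂) hz)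
        h : ltT c₁ tx rest handles A
        h = lt-handles⁺ hx h-rest

      high-heavy : β a ≤ W (A ∖ l₂) → Within budget
      high-heavy βa≤ = lt-within h (begin
        cost w rest + cost w tz                             ≡⟨ cong (_+ cost w tz) (cost-node ltK c₁ tx ty h-rest) ⟩
        (W (A ∩ l₂) + (cost w tx + cost w ty)) + cost w tz  ≤⟨ ℚ.+-monoˡ-≤ (cost w tz) (ℚ.+-monoˡ-≤ _ (∩-light l₂ βa≤)) ⟩
        (W A′ + (cost w tx + cost w ty)) + cost w tz        ≡⟨ solve 4 (λ a x y z → (a :+ (x :+ y)) :+ z := a :+ (x :+ (y :+ z)))
                                                                     refl (W A′) (cost w tx) (cost w ty) (cost w tz) ⟩
        budget                                              ∎)
        where
        open ℚ.≤-Reasoning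
        open +-*-Solver
        rest = ltT c₁ tx ty
        h-rest : rest handles A ∩ l₂
        h-rest = lt-handles⁺ (handles-cong (sym ∘ ∩-absorb′ l₁⊆l₂) hx) (handles-cong ∩-swap hy)
        h : ltT c₂ rest tz handles A
        h = lt-handles⁺ h-rest hz

      Y<A : size Y ℕ.< size A
      Y<A = ℕ.≤-<-trans (∩-size-≤ (A ∖ l₁) l₂) (∖-smaller (handles-nonEmpty hx))

      in-middle : ¬ β a ≤ W (A ∩ l₁) → ¬ β a ≤ W (A ∖ l₂) → ∀ {d} → key d ∈ˢ A → β a ≤ β d → key d ∈ˢ Y
      in-middle ¬heavy₁ ¬heavy₂ {d} d∈A βa≤βd with ∈-or-∈∁ (key d) l₁ | ∈-or-∈∁ (key d) l₂
      ... | inj₁ d∈l₁ | _ = ⊥-elim (¬heavy₁ (ℚ.≤-trans βa≤βd (W-key-≤ (∩⁺ d∈A d∈l₁))))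
      ... | inj₂ _ | inj₂ d∉l₂ = ⊥-elim (¬heavy₂ (ℚ.≤-trans βa≤βd (W-key-≤ (∩⁺ d∈A d∉l₂))))
      ... | inj₂ d∉l₁ | inj₁ d∈l₂ = ∩⁺ (∩⁺ d∈A d∉l₁) d∈l₂

      middle-eqRoot : W (A ∖ l₂) ≤ β b → key b ∈ˢ Y → ∀ t u → eqT b t u handles Y → cost w (eqT b t u) ≤ cost w ty →
                      Within budget
      middle-eqRoot W-A∖l₂≤βb b∈Y t u hTY TY≤ty = peel-within h (begin
        cost w rest                                               ≡⟨ cost-node ltK c₁ tx rest₂ h-rest ⟩
        W (A ∖ e) + (cost w tx + cost w rest₂)                    ≡⟨ cong (λ r → W (A ∖ e) + (cost w tx + r))
                                                                          (cost-node ltK c₂ u tz h-rest₂) ⟩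
        W (A ∖ e) + (cost w tx + (W V + (cost w u + cost w tz)))  ≤⟨ ℚ.+-mono-≤ W-A∖b≤W-A′ (ℚ.+-monoʳ-≤ (cost w tx) (ℚ.+-monoˡ-≤ _ V≤Y)) ⟩
        W A′ + (cost w tx + (W Y + (cost w u + cost w tz)))       ≡⟨ cong (λ r → W A′ + (cost w tx + r))
                                                                          (ℚ.+-assoc (W Y) (cost w u) (cost w tz)) ⟨
        W A′ + (cost w tx + ((W Y + cost w u) + cost w tz))       ≤⟨ ℚ.+-monoʳ-≤ (W A′) (ℚ.+-monoʳ-≤ (cost w tx) (ℚ.+-monoˡ-≤ (cost w tz) Y+u≤ty)) ⟩
        budget                                                    ∎)
        where
        open ℚ.≤-Reasoning
        e = eqTest b
        V = (A ∖ e) ∖ l₁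
        V∩l₂≗Y∖e : V ∩ l₂ ≗ Y ∖ e
        V∩l₂≗Y∖e x = trans (∩-congˡ ∩-swap x) (∩-swap x)
        V∖l₂≗A∖l₂ : V ∖ l₂ ≗ A ∖ l₂
        V∖l₂≗A∖l₂ x = trans (∖-absorb l₁⊆l₂ x) (∖-absorb (eqTest-⊆ (∩⁻ʳ b∈Y)) x)
        rest₂ = ltT c₂ u tz
        h-rest₂ : rest₂ handles V
        h-rest₂ = lt-handles⁺ (handles-cong (sym ∘ V∩l₂≗Y∖e) (proj₂ (eq-handles⁻ hTY)))
                              (handles-cong (sym ∘ V∖l₂≗A∖l₂) hz)
        rest = ltT c₁ tx rest₂
        h-rest : rest handles A ∖ e
        h-rest = lt-handles⁺ (handles-cong (sym ∘ ∩-absorb′ (⊆-∁eqTest (∩⁻ʳ (∩⁻ˡ b∈Y)))) hx) h-rest₂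
        h : peel b rest handles A
        h = peel-handles b∈A h-rest
        V≤Y : W V ≤ W Y
        V≤Y = begin
          W V                        ≡⟨ W-split V l₂ ⟩
          W (V ∩ l₂) + W (V ∖ l₂)    ≡⟨ cong₂ _+_ (W-cong V∩l₂≗Y∖e) (W-cong V∖l₂≗A∖l₂) ⟩
          W (Y ∖ e) + W (A ∖ l₂)     ≤⟨ ℚ.+-monoʳ-≤ (W (Y ∖ e)) W-A∖l₂≤βb ⟩
          W (Y ∖ e) + β b            ≡⟨ ℚ.+-comm (W (Y ∖ e)) (β b) ⟩
          β b + W (Y ∖ e)            ≡⟨ W-key b∈Y ⟨
          W Y                        ∎
        Y+u≤ty : W Y + cost w u ≤ cost w ty
        Y+u≤ty = ℚ.≤-trans (ℚ.+-monoʳ-≤ (W Y) (right-cost-≤ t u ℚ.≤-refl))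
                           (subst (_≤ cost w ty) (cost-node eqK b t u hTY) TY≤ty)

      regroup-handles : ∀ {c t u} → ltT c t u handles Y → ltT c (ltT c₁ tx t) (ltT c₂ u tz) handles A
      regroup-handles {c} hTY = lt-handles⁺ h-left h-right
        where
        l₃ = ltTest c
        ht = proj₁ (lt-handles⁻ hTY)
        hu = proj₂ (lt-handles⁻ hTY)
        l₁⊆l₃ : l₁ ⊆ˢ l₃
        l₁⊆l₃ with handles-nonEmpty ht
        ... | _ , x∈ = ltTest-mono (ltTest-between (∩⁻ʳ (∩⁻ˡ (∩⁻ˡ x∈))) (∩⁻ʳ x∈))
        l₃⊆l₂ : l₃ ⊆ˢ l₂
        l₃⊆l₂ with handles-nonEmpty hu
        ... | _ , x∈ = ltTest-mono (ltTest-between (∩⁻ʳ x∈) (∩⁻ʳ (∩⁻ˡ x∈)))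
        h-left = lt-handles⁺ (handles-cong (sym ∘ ∩-absorb′ l₁⊆l₃) hx)
                             (handles-cong (λ x → trans (trans (∩-swap x) (∩-absorb l₃⊆l₂ x)) (∩-swap x)) ht)
        h-right = lt-handles⁺ (handles-cong (λ x → trans (∩-swap x) (∩-congˡ (∖-absorb l₁⊆l₃) x)) hu)
                              (handles-cong (sym ∘ ∖-absorb l₃⊆l₂) hz)

      middle-ltRoot-cost : key a ∈ˢ Y → ∀ c t u → ltT c t u handles Y → cost w (ltT c t u) ≤ cost w ty →
                           cost w (ltT c₁ tx t) + cost w (ltT c₂ u tz) ≤ budget
      middle-ltRoot-cost a∈Y c t u hTY TY≤ty = begin
        cost w (ltT c₁ tx t) + cost w (ltT c₂ u tz)
          ≡⟨ cong₂ _+_ (cost-node ltK c₁ tx t h-left) (cost-node ltK c₂ u tz h-right) ⟩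
        (W (A ∩ l₃) + (cost w tx + cost w t)) + (W (A ∖ l₃) + (cost w u + cost w tz))
          ≡⟨ solve 6 (λ p q x t u z → (p :+ (x :+ t)) :+ (q :+ (u :+ z)) := (p :+ q) :+ (x :+ ((t :+ u) :+ z))) refl
                     (W (A ∩ l₃)) (W (A ∖ l₃)) (cost w tx) (cost w t) (cost w u) (cost w tz) ⟩
        (W (A ∩ l₃) + W (A ∖ l₃)) + (cost w tx + ((cost w t + cost w u) + cost w tz))
          ≡⟨ cong (_+ (cost w tx + ((cost w t + cost w u) + cost w tz))) (trans (sym (W-split A l₃)) W-A′) ⟩
        (β a + W A′) + (cost w tx + ((cost w t + cost w u) + cost w tz))
          ≤⟨ ℚ.+-monoˡ-≤ _ (ℚ.+-monoˡ-≤ (W A′) (W-key-≤ a∈Y)) ⟩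
        (W Y + W A′) + (cost w tx + ((cost w t + cost w u) + cost w tz))
          ≡⟨ solve 5 (λ y a x t z → (y :+ a) :+ (x :+ (t :+ z)) := a :+ (x :+ ((y :+ t) :+ z))) refl
                     (W Y) (W A′) (cost w tx) (cost w t + cost w u) (cost w tz) ⟩
        W A′ + (cost w tx + ((W Y + (cost w t + cost w u)) + cost w tz))
          ≤⟨ ℚ.+-monoʳ-≤ (W A′) (ℚ.+-monoʳ-≤ (cost w tx) (ℚ.+-monoˡ-≤ (cost w tz) TY≤ty′)) ⟩
        budget
          ∎
        where
        open ℚ.≤-Reasoning
        open +-*-Solver
        l₃ : ItemSet n
        l₃ = ltTest c
        h : ltT c (ltT c₁ tx t) (ltT c₂ u tz) handles A
        h = regroup-handles hTY
        h-left : ltT c₁ tx t handles A ∩ l₃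
        h-left = proj₁ (lt-handles⁻ h)
        h-right : ltT c₂ u tz handles A ∖ l₃
        h-right = proj₂ (lt-handles⁻ h)
        TY≤ty′ : W Y + (cost w t + cost w u) ≤ cost w ty
        TY≤ty′ = subst (_≤ cost w ty) (cost-node ltK c t u hTY) TY≤ty

      middle : key a ∈ˢ Y → key b ∈ˢ Y → ¬ β a ≤ W (A ∖ l₂) → Within budget
      middle a∈Y b∈Y ¬heavy₂ with recurse (∩⁻ˡ ∘ ∩⁻ˡ) Y<A b∈Y a∈Y
      ... | _ , (hTY , TY-opt) , inj₂ (t , u , refl) =
        middle-eqRoot (ℚ.<⇒≤ (ℚ.<-≤-trans (ℚ.≰⇒> ¬heavy₂) βa≤βb)) b∈Y t u hTY (TY-opt ty hy)
      ... | _ , (hTY , TY-opt) , inj₁ (c , t , u , refl) =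
        lt-within (regroup-handles hTY) (middle-ltRoot-cost a∈Y c t u hTY (TY-opt ty hy))

      three-way : Within budget
      three-way with β a ℚ.≤? W (A ∩ l₁) | β a ℚ.≤? W (A ∖ l₂)
      ... | yes heavy₁ | _ = low-heavy heavy₁
      ... | no _ | yes heavy₂ = high-heavy heavy₂
      ... | no ¬heavy₁ | no ¬heavy₂ =
        middle (in-middle ¬heavy₁ ¬heavy₂ a∈A ℚ.≤-refl) (in-middle ¬heavy₁ ¬heavy₂ b∈A βa≤βb) ¬heavy₂

    open ThreeWay using (three-way)

    pair : ¬ NonEmpty (A′ ∖ ⦅ key b ⦆) → Within 0ℚ
    pair no-other = peel-within h (ℚ.≤-reflexive (cost-leaf (key a)))
      where
      only-a : ∀ {y} → y ∈ˢ A ∖ eqTest b → y ≡ key a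
      only-a {y} y∈ with ∈-or-∈∁ y (eqTest a)
      ... | inj₁ y∈a = eqTest⁻ y∈a
      ... | inj₂ y∉a = ⊥-elim (∁⁻ (∩⁻ʳ y∈) (subst (_∈ˢ eqTest b) y≡b (eqTest-self b)))
        where y≡b = sym (∖⦅⦆-empty no-other (∩⁺ (∩⁻ˡ y∈) y∉a))
      h : peel b (leaf (key a)) handles A
      h = peel-handles b∈A (leaf-handles⁺ a∈A∖b only-a)

    from-eqRoot : ∀ t₁ u₁ → eqT b t₁ u₁ handles A′ → Within (cost w (eqT b t₁ u₁))
    from-eqRoot t₁ u₁ h₁ = peel-within h (begin
      cost w (peel a u₁)                 ≡⟨ cost-peel a u₁ h-rest ⟩
      W (A ∖ eqTest b) + cost w u₁       ≤⟨ ℚ.+-mono-≤ W-A∖b≤W-A′ (+-≤-dropˡ (cost-nonNeg t₁) ℚ.≤-refl) ⟩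
      W A′ + (cost w t₁ + cost w u₁)     ≡⟨ cost-node eqK b t₁ u₁ h₁ ⟨
      cost w (eqT b t₁ u₁)               ∎)
      where
      open ℚ.≤-Reasoning
      h-rest : peel a u₁ handles A ∖ eqTest b
      h-rest = peel-handles a∈A∖b (handles-cong ∩-swap (proj₂ (eq-handles⁻ h₁)))
      h : peel b (peel a u₁) handles A
      h = peel-handles b∈A h-rest

    module LowA {c : Fin n} {t₁ u₁ : Tree n} (h₁ : ltT c t₁ u₁ handles A′) (a∈l : key a ∈ˢ ltTest c) where

      l : ItemSet n
      l = ltTest c

      bound : ℚ
      bound = W A′ + (cost w t₁ + cost w u₁)

      hu₁ : u₁ handles A ∖ l
      hu₁ = handles-cong (∖-absorb (eqTest-⊆ a∈l)) (proj₂ (lt-handles⁻ h₁))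

      h-peeled : peel a t₁ handles A ∩ l
      h-peeled = peel-handles (∩⁺ a∈A a∈l) (handles-cong ∩-swap (proj₁ (lt-handles⁻ h₁)))

      beats-peeled : ∀ T₂ → (∀ T′ → T′ handles A ∩ l → cost w T₂ ≤ cost w T′) →
                     cost w T₂ ≤ W (A ∩ l) + cost w t₁
      beats-peeled T₂ T₂-opt = ℚ.≤-trans (T₂-opt (peel a t₁) h-peeled) (ℚ.≤-reflexive (cost-peel a t₁ h-peeled))

      b-high : key b ∈ˢ ∁ l → Within bound
      b-high b∉l = lt-within h (begin
        cost w (peel a t₁) + cost w u₁           ≡⟨ cong (_+ cost w u₁) (cost-peel a t₁ h-peeled) ⟩
        (W (A ∩ l) + cost w t₁) + cost w u₁      ≤⟨ ℚ.+-monoˡ-≤ (cost w u₁) (ℚ.+-monoˡ-≤ (cost w t₁) (∩-light l βa≤W)) ⟩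
        (W A′ + cost w t₁) + cost w u₁           ≡⟨ ℚ.+-assoc (W A′) (cost w t₁) (cost w u₁) ⟩
        bound                                    ∎)
        where
        open ℚ.≤-Reasoning
        βa≤W = ℚ.≤-trans βa≤βb (W-key-≤ (∩⁺ b∈A b∉l))
        h : ltT c (peel a t₁) u₁ handles A
        h = lt-handles⁺ h-peeled hu₁

      b-low-eqRoot : key b ∈ˢ l → ∀ t₂ u₂ → eqT b t₂ u₂ handles A ∩ l →
                     cost w t₂ + cost w u₂ ≤ cost w t₁ → Within bound
      b-low-eqRoot b∈l t₂ u₂ h₂ t₂+u₂≤t₁ = peel-within h (begin
        cost w (ltT c u₂ u₁)                        ≡⟨ cost-node ltK c u₂ u₁ h-rest ⟩
        W (A ∖ eqTest b) + (cost w u₂ + cost w u₁)  ≤⟨ ℚ.+-mono-≤ W-A∖b≤W-A′ (ℚ.+-monoˡ-≤ (cost w u₁) (right-cost-≤ t₂ u₂ t₂+u₂≤t₁)) ⟩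
        bound                                       ∎)
        where
        open ℚ.≤-Reasoning
        h-rest : ltT c u₂ u₁ handles A ∖ eqTest b
        h-rest = lt-handles⁺ (handles-cong ∩-swap (proj₂ (eq-handles⁻ h₂)))
                             (handles-cong (sym ∘ ∖-absorb (eqTest-⊆ b∈l)) hu₁)
        h : peel b (ltT c u₂ u₁) handles A
        h = peel-handles b∈A h-rest

      b-low-ltRoot : ∀ c′ t₂ u₂ → ltT c′ t₂ u₂ handles A ∩ l → cost w t₂ + cost w u₂ ≤ cost w t₁ → Within bound
      b-low-ltRoot c′ t₂ u₂ h₂ t₂+u₂≤t₁ =
        within-≤ (ℚ.+-monoʳ-≤ (W A′) (begin
          cost w t₂ + (cost w u₂ + cost w u₁)   ≡⟨ ℚ.+-assoc (cost w t₂) (cost w u₂) (cost w u₁) ⟨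
          (cost w t₂ + cost w u₂) + cost w u₁   ≤⟨ ℚ.+-monoˡ-≤ (cost w u₁) t₂+u₂≤t₁ ⟩
          cost w t₁ + cost w u₁                 ∎))
          (three-way c′≤c (handles-cong (∩-absorb′ (ltTest-mono c′≤c)) ht₂) (handles-cong ∩-swap hu₂) hu₁)
        where
        open ℚ.≤-Reasoning
        ht₂ = proj₁ (lt-handles⁻ h₂)
        hu₂ = proj₂ (lt-handles⁻ h₂)
        c′≤c : c′ Fin.≤ c
        c′≤c with handles-nonEmpty hu₂
        ... | _ , x∈ = ltTest-between (∩⁻ʳ x∈) (∩⁻ʳ (∩⁻ˡ x∈))

      b-low : key b ∈ˢ l → Within bound
      b-low b∈l with recurse ∩⁻ˡ (∩-smaller (handles-nonEmpty hu₁)) (∩⁺ b∈A b∈l) (∩⁺ a∈A a∈l)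
      ... | _ , (h₂ , T₂-opt) , inj₂ (t₂ , u₂ , refl) =
        b-low-eqRoot b∈l t₂ u₂ h₂ (subtrees-≤ eqK b t₂ u₂ h₂ (beats-peeled (eqT b t₂ u₂) T₂-opt))
      ... | _ , (h₂ , T₂-opt) , inj₁ (c′ , t₂ , u₂ , refl) =
        b-low-ltRoot c′ t₂ u₂ h₂ (subtrees-≤ ltK c′ t₂ u₂ h₂ (beats-peeled (ltT c′ t₂ u₂) T₂-opt))

      result : Within bound
      result with ∈-or-∈∁ (key b) l
      ... | inj₁ b∈l = b-low b∈l
      ... | inj₂ b∉l = b-high b∉l

    module HighA {c : Fin n} {t₁ u₁ : Tree n} (h₁ : ltT c t₁ u₁ handles A′) (a∉l : key a ∈ˢ ∁ (ltTest c)) where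

      l : ItemSet n
      l = ltTest c

      bound : ℚ
      bound = W A′ + (cost w t₁ + cost w u₁)

      ht₁ : t₁ handles A ∩ l
      ht₁ = handles-cong (∩-absorb′ (⊆-∁eqTest a∉l)) (proj₁ (lt-handles⁻ h₁))

      h-peeled : peel a u₁ handles A ∖ l
      h-peeled = peel-handles (∩⁺ a∈A a∉l) (handles-cong ∩-swap (proj₂ (lt-handles⁻ h₁)))

      beats-peeled : ∀ T₂ → (∀ T′ → T′ handles A ∖ l → cost w T₂ ≤ cost w T′) →
                     cost w T₂ ≤ W (A ∖ l) + cost w u₁
      beats-peeled T₂ T₂-opt = ℚ.≤-trans (T₂-opt (peel a u₁) h-peeled) (ℚ.≤-reflexive (cost-peel a u₁ h-peeled))

      b-low : key b ∈ˢ l → Within bound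
      b-low b∈l = lt-within h (begin
        cost w t₁ + cost w (peel a u₁)           ≡⟨ cong (cost w t₁ +_) (cost-peel a u₁ h-peeled) ⟩
        cost w t₁ + (W (A ∖ l) + cost w u₁)      ≤⟨ ℚ.+-monoʳ-≤ (cost w t₁) (ℚ.+-monoˡ-≤ (cost w u₁) (∖-light l βa≤W)) ⟩
        cost w t₁ + (W A′ + cost w u₁)           ≡⟨ x∙yz≈y∙xz (cost w t₁) (W A′) (cost w u₁) ⟩
        bound                                    ∎)
        where
        open ℚ.≤-Reasoning
        βa≤W = ℚ.≤-trans βa≤βb (W-key-≤ (∩⁺ b∈A b∈l))
        h : ltT c t₁ (peel a u₁) handles A
        h = lt-handles⁺ ht₁ h-peeled

      b-high-eqRoot : key b ∈ˢ ∁ l → ∀ t₂ u₂ → eqT b t₂ u₂ handles A ∖ l →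
                      cost w t₂ + cost w u₂ ≤ cost w u₁ → Within bound
      b-high-eqRoot b∉l t₂ u₂ h₂ t₂+u₂≤u₁ = peel-within h (begin
        cost w (ltT c t₁ u₂)                        ≡⟨ cost-node ltK c t₁ u₂ h-rest ⟩
        W (A ∖ eqTest b) + (cost w t₁ + cost w u₂)  ≤⟨ ℚ.+-mono-≤ W-A∖b≤W-A′ (ℚ.+-monoʳ-≤ (cost w t₁) (right-cost-≤ t₂ u₂ t₂+u₂≤u₁)) ⟩
        bound                                       ∎)
        where
        open ℚ.≤-Reasoning
        h-rest : ltT c t₁ u₂ handles A ∖ eqTest b
        h-rest = lt-handles⁺ (handles-cong (sym ∘ ∩-absorb′ (⊆-∁eqTest b∉l)) ht₁)
                             (handles-cong ∩-swap (proj₂ (eq-handles⁻ h₂)))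
        h : peel b (ltT c t₁ u₂) handles A
        h = peel-handles b∈A h-rest

      b-high-ltRoot : ∀ c′ t₂ u₂ → ltT c′ t₂ u₂ handles A ∖ l → cost w t₂ + cost w u₂ ≤ cost w u₁ → Within bound
      b-high-ltRoot c′ t₂ u₂ h₂ t₂+u₂≤u₁ =
        within-≤ (ℚ.+-monoʳ-≤ (W A′) (ℚ.+-monoʳ-≤ (cost w t₁) t₂+u₂≤u₁))
          (three-way c≤c′ ht₁ ht₂ (handles-cong (∖-absorb (ltTest-mono c≤c′)) hu₂))
        where
        ht₂ = proj₁ (lt-handles⁻ h₂)
        hu₂ = proj₂ (lt-handles⁻ h₂)
        c≤c′ : c Fin.≤ c′
        c≤c′ with handles-nonEmpty ht₂
        ... | _ , x∈ = ltTest-between (∩⁻ʳ (∩⁻ˡ x∈)) (∩⁻ʳ x∈)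

      b-high : key b ∈ˢ ∁ l → Within bound
      b-high b∉l with recurse ∩⁻ˡ (∖-smaller (handles-nonEmpty ht₁)) (∩⁺ b∈A b∉l) (∩⁺ a∈A a∉l)
      ... | _ , (h₂ , T₂-opt) , inj₂ (t₂ , u₂ , refl) =
        b-high-eqRoot b∉l t₂ u₂ h₂ (subtrees-≤ eqK b t₂ u₂ h₂ (beats-peeled (eqT b t₂ u₂) T₂-opt))
      ... | _ , (h₂ , T₂-opt) , inj₁ (c′ , t₂ , u₂ , refl) =
        b-high-ltRoot c′ t₂ u₂ h₂ (subtrees-≤ ltK c′ t₂ u₂ h₂ (beats-peeled (ltT c′ t₂ u₂) T₂-opt))

      result : Within bound
      result with ∈-or-∈∁ (key b) l
      ... | inj₁ b∈l = b-low b∈l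
      ... | inj₂ b∉l = b-high b∉l

    from-optimum : ∀ T₁ → T₁ handles A′ → WellRooted b T₁ → Within (cost w T₁)
    from-optimum _ h₁ (inj₂ (t₁ , u₁ , refl)) = from-eqRoot t₁ u₁ h₁
    from-optimum _ h₁ (inj₁ (c , t₁ , u₁ , refl)) = within-≤ (ℚ.≤-reflexive (sym (cost-node ltK c t₁ u₁ h₁))) split-by-a
      where
      split-by-a : Within (W A′ + (cost w t₁ + cost w u₁))
      split-by-a with ∈-or-∈∁ (key a) (ltTest c)
      ... | inj₁ a∈l = LowA.result h₁ a∈l
      ... | inj₂ a∉l = HighA.result h₁ a∉l

    rebuild : ∀ u → u handles A′ → Within (cost w u)
    rebuild u hu with nonEmpty? (A′ ∖ ⦅ key b ⦆)
    ... | no no-other = within-≤ (cost-nonNeg u) (pair no-other)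
    ... | yes other with smaller (∖-smaller (key a , ∩⁺ a∈A (eqTest-self a))) b∈A′ (heaviest ∘ ∩⁻ˡ) other
    ...   | T₁ , (hT₁ , T₁-opt) , root = within-≤ (T₁-opt u hu) (from-optimum T₁ hT₁ root)

    replace-eqRoot : ∀ {t u} → eqT a t u handles A → Σ (Tree n) λ T → T handles A × WellRooted b T × cost w T ≤ cost w (eqT a t u)
    replace-eqRoot {t} {u} h with rebuild u (proj₂ (eq-handles⁻ h))
    ... | T , hT , root , T≤ = T , hT , root , ℚ.≤-trans T≤ (begin
      W A + cost w u               ≤⟨ ℚ.+-monoʳ-≤ (W A) (+-≤-dropˡ (cost-nonNeg t) ℚ.≤-refl) ⟩
      W A + (cost w t + cost w u)  ≡⟨ cost-node eqK a t u h ⟨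
      cost w (eqT a t u)           ∎)
      where open ℚ.≤-Reasoning

  well-rooted-step : ∀ {A} → (∀ {B} → size B ℕ.< size A → WellRootedOptimum B) → WellRootedOptimum A
  well-rooted-step {A} smaller {b} b∈A heaviest (y , y∈) with optimal-exists A (key b , b∈A)
  ... | leaf x , (h , _) = ⊥-elim (∖⦅⦆-≢ y∈ (trans (only (∩⁻ˡ y∈)) (sym (only b∈A))))
    where only = proj₂ (leaf-handles⁻ h)
  ... | ltT c t u , opt = ltT c t u , opt , inj₁ (c , t , u , refl)
  ... | eqT c t u , opt with c Fin.≟ b
  ...   | yes refl = eqT c t u , opt , inj₂ (t , u , refl)
  ...   | no c≢b =
    let T , hT , root , T≤ = Step.replace-eqRoot smaller c≢b (eq-handles⇒∈ (proj₁ opt)) b∈A heaviest (proj₁ opt)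
    in T , cheaper-optimal opt hT T≤ , root

  well-rooted-optimum : ∀ A → WellRootedOptimum A
  well-rooted-optimum = WF.All.wfRec (On.wellFounded size ℕ.<-wellFounded) 0ℓ WellRootedOptimum (λ _ → well-rooted-step)

  heaviest-root : ∀ {A b} → key b ∈ˢ A → Heaviest A b → Σ (Tree n) λ T → Optimal A T × (IsLeaf T ⊎ WellRooted b T)
  heaviest-root {A} {b} b∈A heaviest with nonEmpty? (A ∖ ⦅ key b ⦆)
  ... | no no-other = leaf (key b) , leaf-optimal b∈A (∖⦅⦆-empty no-other) , inj₁ (key b , refl)
  ... | yes other with well-rooted-optimum A b∈A heaviest other
  ...   | T , opt , root = T , opt , inj₂ root

inSijh? : ∀ {n} (π : Permutation′ n) i j h x → Dec (InSijh π i j h x)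
inSijh? π i j h (key c) = (i ℕ.≤? pos c) ×-dec (suc (pos c) ℕ.≤? j) ×-dec (suc (toℕ (π ⟨$⟩ˡ c)) ℕ.≤? h)
inSijh? π i j h (gap a) = (i ℕ.≤? toℕ a) ×-dec (suc (toℕ a) ℕ.≤? j)

-- Validity is used only to make membership in S decidable.
valid-decidable : ∀ {n} {π : Permutation′ n} {S} → Valid π S → Σ (ItemSet n) λ A → ∀ x → S x ⇔ x ∈ˢ A
valid-decidable (inj₁ (b , S⇔b)) = decidable-set (_≟ᴵ key b) S⇔b
valid-decidable {π = π} (inj₂ (i , j , h , _ , _ , _ , S⇔Sijh)) = decidable-set (inSijh? π i j h) S⇔Sijh

theorem1 : (n : ℕ) (β : Fin n → ℚ) (α : Fin (suc n) → ℚ)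
    → (∀ b → 0ℚ ≤ β b) → (∀ a → 0ℚ ≤ α a)
    → (π : Permutation′ n) → Sorted β π
    → (S : Item n → Set) → Valid π S
    → (b : Fin n) → S (key b) → (∀ c → S (key c) → β c ≤ β b)
    → Σ (Tree n) λ T → Handles T S
        × (∀ T′ → Handles T′ S → cost (weight β α) T ≤ cost (weight β α) T′)
        × (IsLeaf T ⊎ RootIsLt T ⊎ RootIsEqTo b T)
theorem1 n β α β≥0 α≥0 π _ S valid b b∈S heaviest with valid-decidable valid
... | A , S⇔A with Exchange.heaviest-root β α β≥0 α≥0 (Equivalence.to (S⇔A (key b)) b∈S)
                                                    (heaviest _ ∘ Equivalence.from (S⇔A _))
...   | T , (hT , T-opt) , shape =
  T , Equivalence.from S≈A hT , (λ T′ h′ → T-opt T′ (Equivalence.to S≈A h′)) , shape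
  where
  S≈A : ∀ {T} → Handles T S ⇔ T handles A
  S≈A = Handles⇔handles S⇔A
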